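{- Let $G_1,G_2$ be graphs and $G=G_1\triangle G_2$. Then $\mathbb{E}\rho(G)\le\mathbb{E}\rho(G_1)+\mathbb{E}\rho(G_2)$, with equality if $V(G_1)\cap V(G_2)=\emptyset$. In particular, for every vertex $v$ of $G$, $\mathbb{E}\rho(G-v)\ge\mathbb{E}\rho(G)-1+2^{ -d_G(v)}\ge\mathbb{E}\rho(G)-1+2^{1-|V(G)|}$.
   Context: Graphs are finite and simple. $\rho_G(X)$ is the binary rank of the $X\times(V(G)\setminus X)$ adjacency submatrix; $\mathbb{E}\rho(G)=2^{ -|V(G)|}\sum_{S\subseteq V(G)}\rho_G(S)$. The symmetric difference $G_1\triangle G_2$ is the graph with vertex set $V(G_1)\cup V(G_2)$ and edge set $E(G_1)\triangle E(G_2)$. $d_G(v)$ is the degree of $v$. -}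

module Defs where

open import Data.Nat using (ℕ; zero; suc; _+_; _⊔_; _^_)
open import Data.Nat.Properties using (m^n≢0)
open import Data.Bool using (Bool; true; false; _∧_; _∨_; _xor_; not; if_then_else_)
open import Data.Bool.Properties using (∨-zeroʳ)
open import Data.Fin using (Fin; zero; suc; _≟_)
open import Data.List using (List; []; _∷_; [_]; _++_; map; foldr; filterᵇ)
open import Data.Bool.ListAction using (all)
open import Data.Nat.ListAction using (sum)
open import Data.Product using (_×_; _,_)
open import Data.Integer using (+_)
open import Data.Rational using (ℚ; _/_)
open import Relation.Nullary.Decidable using (⌊_⌋)
open import Relation.Binary.PropositionalEquality using (_≡_; refl)

VSet : ℕ → Set
VSet n = Fin n → Bool

bigOr : ∀ {n} → (Fin n → Bool) → Bool
bigOr {zero} f = false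
bigOr {suc n} f = f zero ∨ bigOr (λ i → f (suc i))

bigXor : ∀ {n} → (Fin n → Bool) → Bool
bigXor {zero} f = false
bigXor {suc n} f = f zero xor bigXor (λ i → f (suc i))

card : ∀ {n} → VSet n → ℕ
card {zero} f = 0
card {suc n} f = (if f zero then 1 else 0) + card (λ i → f (suc i))

consB : ∀ {n} → Bool → VSet n → VSet (suc n)
consB b f zero = b
consB b f (suc i) = f i

-- list of all subsets S ⊆ X (each exactly once)
subsetsOf : ∀ {n} → VSet n → List (VSet n)
subsetsOf {zero} X = [ (λ ()) ]
subsetsOf {suc n} X with X zero
... | true  = map (consB false) rest ++ map (consB true) rest
  where rest = subsetsOf (λ i → X (suc i))
... | false = map (consB false) (subsetsOf (λ i → X (suc i)))

record Graph (n : ℕ) : Set where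
  field
    V      : VSet n
    adj    : Fin n → Fin n → Bool
    sym    : ∀ u w → adj u w ≡ adj w u
    irrefl : ∀ u → adj u u ≡ false
    closed : ∀ u w → adj u w ≡ true → (V u ≡ true) × (V w ≡ true)
open Graph public

rowSum : ∀ {n} → (Fin n → Fin n → Bool) → VSet n → Fin n → Bool
rowSum A T c = bigXor (λ i → T i ∧ A i c)

nonzeroComb : ∀ {n} → (Fin n → Fin n → Bool) → VSet n → VSet n → Bool
nonzeroComb A C T = bigOr (λ c → C c ∧ rowSum A T c)

independentRows : ∀ {n} → (Fin n → Fin n → Bool) → VSet n → VSet n → Bool
independentRows A C T = all (λ T' → not (bigOr T') ∨ nonzeroComb A C T') (subsetsOf T)

maxList : List ℕ → ℕ
maxList = foldr _⊔_ 0

binRank : ∀ {n} → (Fin n → Fin n → Bool) → VSet n → VSet n → ℕ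
binRank A X C = maxList (map card (filterᵇ (independentRows A C) (subsetsOf X)))

ρ : ∀ {n} → Graph n → VSet n → ℕ
ρ G X = binRank (adj G) X (λ c → V G c ∧ not (X c))

∣V∣ : ∀ {n} → Graph n → ℕ
∣V∣ G = card (V G)

𝔼ρ : ∀ {n} → Graph n → ℚ
𝔼ρ G = _/_ (+ sum (map (ρ G) (subsetsOf (V G)))) (2 ^ ∣V∣ G) {{m^n≢0 2 (∣V∣ G)}}

deg : ∀ {n} → Graph n → Fin n → ℕ
deg G v = card (adj G v)

open import Data.Sum using (_⊎_; inj₁; inj₂)

private
  xt : ∀ a b → a xor b ≡ true → (a ≡ true) ⊎ (b ≡ true)
  xt true  b _ = inj₁ refl
  xt false b e = inj₂ e

  orL : ∀ {a} b → a ≡ true → a ∨ b ≡ true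
  orL b refl = refl

  orR : ∀ a {b} → b ≡ true → a ∨ b ≡ true
  orR true  _ = refl
  orR false e = e

  xor-sym : ∀ a b c d → a ≡ c → b ≡ d → a xor b ≡ c xor d
  xor-sym a b c d refl refl = refl

_△_ : ∀ {n} → Graph n → Graph n → Graph n
G₁ △ G₂ = record
  { V      = λ u → V G₁ u ∨ V G₂ u
  ; adj    = λ u w → adj G₁ u w xor adj G₂ u w
  ; sym    = λ u w → xor-sym _ _ _ _ (sym G₁ u w) (sym G₂ u w)
  ; irrefl = λ u → irr (irrefl G₁ u) (irrefl G₂ u)
  ; closed = cl
  }
  where
  irr : ∀ {a b} → a ≡ false → b ≡ false → a xor b ≡ false
  irr refl refl = refl
  cl : ∀ u w → adj G₁ u w xor adj G₂ u w ≡ true →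
       ((V G₁ u ∨ V G₂ u) ≡ true) × ((V G₁ w ∨ V G₂ w) ≡ true)
  cl u w e with xt _ _ e
  ... | inj₁ e₁ with closed G₁ u w e₁
  ...   | (a , b) = orL _ a , orL _ b
  cl u w e | inj₂ e₂ with closed G₂ u w e₂
  ...   | (a , b) = orR _ a , orR _ b

_≠ᵇ_ : ∀ {n} → Fin n → Fin n → Bool
u ≠ᵇ v = not ⌊ u ≟ v ⌋

private
  ∧-true : ∀ a b → a ∧ b ≡ true → (a ≡ true) × (b ≡ true)
  ∧-true true true refl = refl , refl

  ∧-intro : ∀ {a b} → a ≡ true → b ≡ true → a ∧ b ≡ true
  ∧-intro refl refl = refl

  ∧-false : ∀ {a} b → a ≡ false → a ∧ b ≡ false
  ∧-false b refl = refl

_－_ : ∀ {n} → Graph n → Fin n → Graph n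
G － v = record
  { V      = λ u → V G u ∧ (u ≠ᵇ v)
  ; adj    = λ u w → adj G u w ∧ ((u ≠ᵇ v) ∧ (w ≠ᵇ v))
  ; sym    = λ u w → sy u w
  ; irrefl = λ u → ∧-false _ (irrefl G u)
  ; closed = cl
  }
  where
  ∧-comm' : ∀ a b → a ∧ b ≡ b ∧ a
  ∧-comm' true true = refl
  ∧-comm' true false = refl
  ∧-comm' false true = refl
  ∧-comm' false false = refl
  sy : ∀ u w → adj G u w ∧ ((u ≠ᵇ v) ∧ (w ≠ᵇ v)) ≡ adj G w u ∧ ((w ≠ᵇ v) ∧ (u ≠ᵇ v))
  sy u w with adj G u w | adj G w u | sym G u w | ∧-comm' (u ≠ᵇ v) (w ≠ᵇ v)
  ... | a | .a | refl | e rewrite e = refl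
  cl : ∀ u w → adj G u w ∧ ((u ≠ᵇ v) ∧ (w ≠ᵇ v)) ≡ true →
       ((V G u ∧ (u ≠ᵇ v)) ≡ true) × ((V G w ∧ (w ≠ᵇ v)) ≡ true)
  cl u w e with ∧-true _ _ e
  ... | (e₁ , e₂) with ∧-true _ _ e₂ | closed G u w e₁
  ...   | (a , b) | (c , d) = ∧-intro c a , ∧-intro d b

module Submission where

-- For S ⊆ V(G₁ △ G₂), every row of the S × (V ∖ S) adjacency matrix of G₁ △ G₂ is the GF(2)-sum of
-- the corresponding rows of G₁ and G₂, restricted to the columns outside S. The rows of Gᵢ indexed by S
-- are spanned by the rows of a basis, i.e. by ρ_{Gᵢ}(S ∩ V(Gᵢ)) vectors, so the Steinitz exchange lemma
-- gives ρ_{G₁ △ G₂}(S) ≤ ρ_{G₁}(S ∩ V(G₁)) + ρ_{G₂}(S ∩ V(G₂)); when the vertex sets are disjoint, the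
-- union of the two bases stays independent, which gives equality. When S is uniform over the subsets
-- of V(G₁ △ G₂), S ∩ V(Gᵢ) is uniform over the subsets of V(Gᵢ), so averaging over S proves the first part.
-- For the second part, G = (G − v) △ H for the star H formed by the edges at v, hence
-- 𝔼ρ(G) ≤ 𝔼ρ(G − v) + 𝔼ρ(H). Every row of H is a multiple of one vector, so ρ_H ≤ 1, and ρ_H vanishes at
-- ∅ and at V(H); as |V(H)| = d(v) + 1, this gives 𝔼ρ(H) ≤ 1 − 2 · 2^{-(d(v)+1)} = 1 − 2^{-d(v)}.
-- Finally d(v) + 1 ≤ |V(G)|.

open import Defs hiding (sym)

module BinaryRank where

  import Algebra
  open import Data.Bool using (Bool; true; false; _∧_; _∨_; _xor_; not; if_then_else_)
  import Data.Bool.Properties as Bool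
  open import Data.Bool.ListAction using (all)
  open import Data.Empty using (⊥-elim)
  open import Data.Fin using (Fin; zero; suc; _≟_)
  open import Data.List using (List; []; _∷_; [_]; _++_; map; length; filterᵇ)
  import Data.List.Properties as List
  open import Data.List.Relation.Unary.All as All using (All; []; _∷_)
  import Data.List.Relation.Unary.All.Properties as All
  open import Data.List.Relation.Unary.Any as Any using (Any; here; there)
  import Data.List.Relation.Unary.Any.Properties as Any
  open import Data.Nat using (ℕ; zero; suc; _+_; _*_; _^_; _≤_; _<_; z≤n; s≤s)
  open import Data.Nat.ListAction using (sum)
  open import Data.Nat.ListAction.Properties using (sum-++)
  import Data.Nat.Properties as ℕ
  open import Data.Nat.Tactic.RingSolver using (solve-∀)
  open import Data.Product using (Σ; ∃-syntax; _×_; _,_; proj₁; proj₂)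
  open import Data.Sum as Sum using (_⊎_; inj₁; inj₂)
  open import Data.Vec.Functional using (tail)
  open import Function using (_∘_; id)
  open import Relation.Binary.PropositionalEquality hiding ([_])
  open import Relation.Nullary using (yes; no)
  open import Relation.Nullary.Decidable using (⌊_⌋)

  private
    variable
      m n k : ℕ

  true≢false : true ≢ false
  true≢false ()

  ∧-≡-true : ∀ {a b} → a ∧ b ≡ true → a ≡ true × b ≡ true
  ∧-≡-true {true} {true} refl = refl , refl

  ∧-intro : ∀ {a b} → a ≡ true → b ≡ true → a ∧ b ≡ true
  ∧-intro refl refl = refl

  ∨-≡-true : ∀ {a b} → a ∨ b ≡ true → a ≡ true ⊎ b ≡ true
  ∨-≡-true {true}  _ = inj₁ refl
  ∨-≡-true {false} e = inj₂ e

  ∨-introˡ : ∀ {a} b → a ≡ true → a ∨ b ≡ true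
  ∨-introˡ b refl = refl

  ∨-introʳ : ∀ a {b} → b ≡ true → a ∨ b ≡ true
  ∨-introʳ a refl = Bool.∨-zeroʳ a

  xor-≡-true : ∀ {a b} → a xor b ≡ true → a ≡ true ⊎ b ≡ true
  xor-≡-true {true}  _ = inj₁ refl
  xor-≡-true {false} e = inj₂ e

  xor-≡-false : ∀ {a b} → a xor b ≡ false → a ≡ b
  xor-≡-false {true}  {true}  _ = refl
  xor-≡-false {false} {false} _ = refl

  not-≡-true : ∀ {a} → not a ≡ true → a ≡ false
  not-≡-true {false} _ = refl

  not-∨-≡-false : ∀ {a b} → not a ∨ b ≡ false → a ≡ true × b ≡ false
  not-∨-≡-false {true} {false} _ = refl , refl

  xor-commutativeSemigroup : Algebra.CommutativeSemigroup _ _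
  xor-commutativeSemigroup = Algebra.CommutativeRing.+-commutativeSemigroup Bool.xor-∧-commutativeRing

  open import Algebra.Properties.CommutativeSemigroup xor-commutativeSemigroup
    using (interchange; xy∙z≈xz∙y)
  open import Algebra.Properties.CommutativeSemigroup ℕ.+-commutativeSemigroup
    using () renaming (interchange to +-interchange)

  xor-cancelʳ : ∀ a b c → (a xor c) xor (b xor c) ≡ a xor b
  xor-cancelʳ a b c = begin
    (a xor c) xor (b xor c)  ≡⟨ interchange a c b c ⟩
    (a xor b) xor (c xor c)  ≡⟨ cong ((a xor b) xor_) (Bool.xor-same c) ⟩
    (a xor b) xor false      ≡⟨ Bool.xor-identityʳ _ ⟩
    a xor b                  ∎
    where open ≡-Reasoning

  xor-cancelˡ : ∀ a b → (a xor b) xor a ≡ b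
  xor-cancelˡ a b = trans (xy∙z≈xz∙y a b a) (cong (_xor b) (Bool.xor-same a))

  infix  4 _≐_ _⊆_ _≈_
  infixl 6 _⊕_ _∪_
  infixr 7 _·_ _∩_
  infixl 7 _∖_

  _≐_ : VSet n → VSet n → Set
  X ≐ Y = ∀ i → X i ≡ Y i

  _⊆_ : VSet n → VSet n → Set
  X ⊆ Y = ∀ i → X i ≡ true → Y i ≡ true

  ≐⇒⊆ : {X Y : VSet n} → X ≐ Y → X ⊆ Y
  ≐⇒⊆ X≐Y i xi = trans (sym (X≐Y i)) xi

  ∅ : VSet n
  ∅ _ = false

  _∩_ : VSet n → VSet n → VSet n
  (X ∩ Y) i = X i ∧ Y i

  _∪_ : VSet n → VSet n → VSet n
  (X ∪ Y) i = X i ∨ Y i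

  _∖_ : VSet n → VSet n → VSet n
  (X ∖ Y) i = X i ∧ not (Y i)

  Nonempty : VSet n → Set
  Nonempty X = ∃[ i ] X i ≡ true

  _≡ᵇ_ : Fin n → Fin n → Bool
  i ≡ᵇ j = ⌊ i ≟ j ⌋

  ⁅_⁆ : Fin n → VSet n
  ⁅ j ⁆ i = i ≡ᵇ j

  ≡ᵇ-refl : (i : Fin n) → i ≡ᵇ i ≡ true
  ≡ᵇ-refl i with i ≟ i
  ... | yes _   = refl
  ... | no  i≢i = ⊥-elim (i≢i refl)

  ≡ᵇ⇒≡ : {i j : Fin n} → i ≡ᵇ j ≡ true → i ≡ j
  ≡ᵇ⇒≡ {i = i} {j} e with i ≟ j
  ... | yes i≡j = i≡j

  ≡ᵇ-suc : (i j : Fin n) → suc i ≡ᵇ suc j ≡ i ≡ᵇ j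
  ≡ᵇ-suc i j with i ≟ j
  ... | yes refl = refl
  ... | no  _    = refl

  ⁅⁆-⊆ : {X : VSet n} {j : Fin n} → X j ≡ true → ⁅ j ⁆ ⊆ X
  ⁅⁆-⊆ xj i e rewrite ≡ᵇ⇒≡ e = xj

  ∖⁅⁆-removes : (X : VSet n) (j : Fin n) → (X ∖ ⁅ j ⁆) j ≡ false
  ∖⁅⁆-removes X j = trans (cong (λ b → X j ∧ not b) (≡ᵇ-refl j)) (Bool.∧-zeroʳ (X j))

  ∖⁅⁆-∪⁅⁆ : (X : VSet n) (j : Fin n) → X j ≡ true → X ≐ X ∖ ⁅ j ⁆ ∪ ⁅ j ⁆
  ∖⁅⁆-∪⁅⁆ X j xj i with i ≟ j
  ... | yes refl = trans xj (sym (Bool.∨-zeroʳ _))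
  ... | no  _    = sym (trans (Bool.∨-identityʳ _) (Bool.∧-identityʳ (X i)))

  empty⊎nonempty : (X : VSet n) → X ≐ ∅ ⊎ Nonempty X
  empty⊎nonempty {zero}  X = inj₁ λ ()
  empty⊎nonempty {suc n} X with X zero in x₀ | empty⊎nonempty (tail X)
  ... | true  | _            = inj₂ (zero , x₀)
  ... | false | inj₁ empty   = inj₁ λ { zero → x₀ ; (suc i) → empty i }
  ... | false | inj₂ (i , p) = inj₂ (suc i , p)

  card-cong : {X Y : VSet n} → X ≐ Y → card X ≡ card Y
  card-cong {zero}  e = refl
  card-cong {suc n} e = cong₂ _+_ (cong (λ b → if b then 1 else 0) (e zero)) (card-cong (e ∘ suc))

  card-tail : (X : VSet (suc n)) {a : Bool} → X zero ≡ a → card X ≡ (if a then 1 else 0) + card (tail X)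
  card-tail X x₀ rewrite x₀ = refl

  card-empty : (X : VSet n) → X ≐ ∅ → card X ≡ 0
  card-empty {zero}  X empty = refl
  card-empty {suc n} X empty rewrite empty zero = card-empty (tail X) (empty ∘ suc)

  card-mono : (X Y : VSet n) → X ⊆ Y → card X ≤ card Y
  card-mono {zero}  X Y X⊆Y = z≤n
  card-mono {suc n} X Y X⊆Y with X zero in x₀ | Y zero in y₀ | card-mono (tail X) (tail Y) (X⊆Y ∘ suc)
  ... | true  | true  | le = s≤s le
  ... | true  | false | _  = ⊥-elim (true≢false (trans (sym (X⊆Y zero x₀)) y₀))
  ... | false | true  | le = ℕ.m≤n⇒m≤1+n le
  ... | false | false | le = le

  card-∪-disjoint : (X Y : VSet n) → X ∩ Y ≐ ∅ → card (X ∪ Y) ≡ card X + card Y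
  card-∪-disjoint {zero}  X Y disjoint = refl
  card-∪-disjoint {suc n} X Y disjoint
    with X zero | Y zero | disjoint zero | card-∪-disjoint (tail X) (tail Y) (disjoint ∘ suc)
  ... | true  | false | _ | e = cong suc e
  ... | false | true  | _ | e = trans (cong suc e) (sym (ℕ.+-suc _ _))
  ... | false | false | _ | e = e

  card-∪⁅⁆ : (X : VSet n) (j : Fin n) → X j ≡ false → card (X ∪ ⁅ j ⁆) ≡ suc (card X)
  card-∪⁅⁆ {suc n} X zero xj rewrite xj = cong suc (card-cong λ i → Bool.∨-identityʳ (X (suc i)))
  card-∪⁅⁆ {suc n} X (suc j) xj
    with X zero | trans (card-cong λ i → cong (X (suc i) ∨_) (≡ᵇ-suc i j)) (card-∪⁅⁆ (tail X) j xj)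
  ... | true  | e = cong suc e
  ... | false | e = e

  card-∖⁅⁆ : (X : VSet n) (j : Fin n) → X j ≡ true → card X ≡ suc (card (X ∖ ⁅ j ⁆))
  card-∖⁅⁆ X j xj = trans (card-cong (∖⁅⁆-∪⁅⁆ X j xj)) (card-∪⁅⁆ (X ∖ ⁅ j ⁆) j (∖⁅⁆-removes X j))

  subsetsOf-cong : {X Y : VSet n} → X ≐ Y → subsetsOf X ≡ subsetsOf Y
  subsetsOf-cong {zero}  e = refl
  subsetsOf-cong {suc n} {X} {Y} e
    with X zero | Y zero | e zero | subsetsOf-cong {X = tail X} {tail Y} (e ∘ suc)
  ... | true  | true  | refl | e′ = cong (λ R → map (consB false) R ++ map (consB true) R) e′
  ... | false | false | refl | e′ = cong (map (consB false)) e′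

  consB-cong : (b : Bool) {S T : VSet n} → S ≐ T → consB b S ≐ consB b T
  consB-cong b S≐T zero    = refl
  consB-cong b S≐T (suc i) = S≐T i

  consB-≐ : {b : Bool} {S : VSet n} {T : VSet (suc n)} → T zero ≡ b → S ≐ tail T → consB b S ≐ T
  consB-≐ t₀ e zero    = sym t₀
  consB-≐ t₀ e (suc i) = e i

  consB-⊆ : {b : Bool} {S : VSet n} {X : VSet (suc n)} →
            (b ≡ true → X zero ≡ true) → S ⊆ tail X → consB b S ⊆ X
  consB-⊆ b⇒x₀ S⊆X zero    e = b⇒x₀ e
  consB-⊆ b⇒x₀ S⊆X (suc i) e = S⊆X i e

  consB-∩ : (b : Bool) (S : VSet n) {X : VSet (suc n)} {a : Bool} → X zero ≡ a →
            consB b S ∩ X ≐ consB (b ∧ a) (S ∩ tail X)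
  consB-∩ b S x₀ zero    = cong (b ∧_) x₀
  consB-∩ b S x₀ (suc i) = refl

  subsetsOf-⊆ : (X : VSet n) → All (_⊆ X) (subsetsOf X)
  subsetsOf-⊆ {zero}  X = (λ ()) ∷ []
  subsetsOf-⊆ {suc n} X with X zero in x₀ | subsetsOf-⊆ (tail X)
  ... | true  | rest = All.++⁺ (All.map⁺ (All.map (consB-⊆ λ ()) rest))
                               (All.map⁺ (All.map (consB-⊆ λ _ → x₀) rest))
  ... | false | rest = All.map⁺ (All.map (consB-⊆ λ ()) rest)

  ⊆-subsetsOf : (X T : VSet n) → T ⊆ X → Any (_≐ T) (subsetsOf X)
  ⊆-subsetsOf {zero}  X T T⊆X = here λ ()
  ⊆-subsetsOf {suc n} X T T⊆X with X zero in x₀ | T zero in t₀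
  ... | true  | false = Any.++⁺ˡ (Any.map⁺ (Any.map (consB-≐ t₀) rest))
    where rest = ⊆-subsetsOf (tail X) (tail T) (T⊆X ∘ suc)
  ... | true  | true  = Any.++⁺ʳ _ (Any.map⁺ (Any.map (consB-≐ t₀) rest))
    where rest = ⊆-subsetsOf (tail X) (tail T) (T⊆X ∘ suc)
  ... | false | false = Any.map⁺ (Any.map (consB-≐ t₀) rest)
    where rest = ⊆-subsetsOf (tail X) (tail T) (T⊆X ∘ suc)
  ... | false | true  = ⊥-elim (true≢false (trans (sym (T⊆X zero t₀)) x₀))

  -- Linear algebra over GF(2)

  bigXor-cong : {f g : Fin n → Bool} → (∀ i → f i ≡ g i) → bigXor f ≡ bigXor g
  bigXor-cong {zero}  e = refl
  bigXor-cong {suc n} e = cong₂ _xor_ (e zero) (bigXor-cong (e ∘ suc))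

  bigXor-false : (f : Fin n → Bool) → (∀ i → f i ≡ false) → bigXor f ≡ false
  bigXor-false {zero}  f e = refl
  bigXor-false {suc n} f e rewrite e zero = bigXor-false (tail f) (e ∘ suc)

  bigXor-xor : (f g : Fin n → Bool) → bigXor (λ i → f i xor g i) ≡ bigXor f xor bigXor g
  bigXor-xor {zero}  f g = refl
  bigXor-xor {suc n} f g = trans (cong ((f zero xor g zero) xor_) (bigXor-xor (tail f) (tail g)))
                                 (interchange (f zero) (g zero) _ _)

  ∧-distribˡ-bigXor : ∀ a (f : Fin n → Bool) → a ∧ bigXor f ≡ bigXor (λ i → a ∧ f i)
  ∧-distribˡ-bigXor {zero}  a f = Bool.∧-zeroʳ a
  ∧-distribˡ-bigXor {suc n} a f = trans (Bool.∧-distribˡ-xor a (f zero) _)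
                                        (cong ((a ∧ f zero) xor_) (∧-distribˡ-bigXor a (tail f)))

  bigXor-⁅⁆ : (f : Fin n → Bool) (j : Fin n) → bigXor (λ i → (i ≡ᵇ j) ∧ f i) ≡ f j
  bigXor-⁅⁆ f zero =
    trans (cong (f zero xor_) (bigXor-false (λ i → (suc i ≡ᵇ zero) ∧ f (suc i)) λ _ → refl))
          (Bool.xor-identityʳ (f zero))
  bigXor-⁅⁆ f (suc j) =
    trans (bigXor-cong λ i → cong (_∧ f (suc i)) (≡ᵇ-suc i j)) (bigXor-⁅⁆ (tail f) j)

  Vect : ℕ → Set
  Vect k = Fin k → Bool

  _⊕_ : Vect k → Vect k → Vect k
  (u ⊕ v) c = u c xor v c

  _·_ : Bool → Vect k → Vect k
  (a · v) c = a ∧ v c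

  IsZero : Vect k → Set
  IsZero v = ∀ c → v c ≡ false

  IsNonzero : Vect k → Set
  IsNonzero v = ∃[ c ] v c ≡ true

  ∑ : (Fin m → Vect k) → VSet m → Vect k
  ∑ f U c = bigXor (λ i → U i ∧ f i c)

  Independent : (Fin m → Vect k) → VSet m → Set
  Independent f T = ∀ U → U ⊆ T → Nonempty U → IsNonzero (∑ f U)

  Dependent : (Fin m → Vect k) → VSet m → Set
  Dependent f T = ∃[ U ] U ⊆ T × Nonempty U × IsZero (∑ f U)

  ∑-cong : (f : Fin m → Vect k) {U U′ : VSet m} → U ≐ U′ → ∑ f U ≐ ∑ f U′
  ∑-cong f e c = bigXor-cong λ i → cong (_∧ f i c) (e i)

  ∑-⊕-rows : (f g : Fin m → Vect k) (U : VSet m) → ∑ (λ i → f i ⊕ g i) U ≐ ∑ f U ⊕ ∑ g U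
  ∑-⊕-rows f g U c = trans (bigXor-cong λ i → Bool.∧-distribˡ-xor (U i) (f i c) (g i c))
                           (bigXor-xor (λ i → U i ∧ f i c) (λ i → U i ∧ g i c))

  ∑-⊕-sets : (f : Fin m → Vect k) (U U′ : VSet m) → ∑ f (U ⊕ U′) ≐ ∑ f U ⊕ ∑ f U′
  ∑-⊕-sets f U U′ c = trans (bigXor-cong λ i → Bool.∧-distribʳ-xor (f i c) (U i) (U′ i))
                            (bigXor-xor (λ i → U i ∧ f i c) (λ i → U′ i ∧ f i c))

  ∑-·-rows : (α : Fin m → Bool) (v : Vect k) (U : VSet m) →
             ∑ (λ i → α i · v) U ≐ bigXor (U ∩ α) · v
  ∑-·-rows α v U c =
    trans (bigXor-cong λ i → trans (sym (Bool.∧-assoc (U i) (α i) (v c))) (Bool.∧-comm _ (v c)))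
          (trans (sym (∧-distribˡ-bigXor (v c) (U ∩ α))) (Bool.∧-comm (v c) _))

  ∑-·-sets : (f : Fin m → Vect k) (a : Bool) (U : VSet m) → ∑ f (a · U) ≐ a · ∑ f U
  ∑-·-sets f a U c = trans (bigXor-cong λ i → Bool.∧-assoc a (U i) (f i c))
                           (sym (∧-distribˡ-bigXor a (λ i → U i ∧ f i c)))

  ∑-⁅⁆ : (f : Fin m → Vect k) (j : Fin m) → ∑ f ⁅ j ⁆ ≐ f j
  ∑-⁅⁆ f j c = bigXor-⁅⁆ (λ i → f i c) j

  ∖⁅⁆-⊕⁅⁆ : (X : VSet n) (j : Fin n) → X j ≡ true → X ≐ X ∖ ⁅ j ⁆ ⊕ ⁅ j ⁆
  ∖⁅⁆-⊕⁅⁆ X j xj i with i ≟ j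
  ... | yes refl = trans xj (cong (_xor true) (sym (Bool.∧-zeroʳ (X i))))
  ... | no  _    = sym (trans (Bool.xor-identityʳ _) (Bool.∧-identityʳ (X i)))

  Independent-mono : (f : Fin m → Vect k) {T T′ : VSet m} → T′ ⊆ T → Independent f T → Independent f T′
  Independent-mono f T′⊆T ind U U⊆T′ = ind U λ i → T′⊆T i ∘ U⊆T′ i

  Independent-cong : {f g : Fin m → Vect k} → (∀ i → f i ≐ g i) →
                     {T : VSet m} → Independent f T → Independent g T
  Independent-cong f≐g ind U U⊆T ne with ind U U⊆T ne
  ... | c , nz = c , trans (bigXor-cong λ i → cong (U i ∧_) (sym (f≐g i c))) nz

  Independent⇒row-nonzero : (f : Fin m → Vect k) {T : VSet m} → Independent f T →
                            ∀ {i} → T i ≡ true → IsNonzero (f i)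
  Independent⇒row-nonzero f ind {i} ti with ind ⁅ i ⁆ (⁅⁆-⊆ ti) (i , ≡ᵇ-refl i)
  ... | c , nz = c , trans (sym (∑-⁅⁆ f i c)) nz

  data Span {k} : List (Vect k) → Vect k → Set where
    nil  : ∀ {v} → IsZero v → Span [] v
    skip : ∀ {g gs v} → Span gs v → Span (g ∷ gs) v
    take : ∀ {g gs v} → Span gs (v ⊕ g) → Span (g ∷ gs) v

  Span-cong : {gs : List (Vect k)} {u v : Vect k} → u ≐ v → Span gs u → Span gs v
  Span-cong e (nil z)  = nil λ c → trans (sym (e c)) (z c)
  Span-cong e (skip s) = skip (Span-cong e s)
  Span-cong e (take s) = take (Span-cong (λ c → cong (_xor _) (e c)) s)

  Span-zero : (gs : List (Vect k)) {v : Vect k} → IsZero v → Span gs v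
  Span-zero []       z = nil z
  Span-zero (g ∷ gs) z = skip (Span-zero gs z)

  Span-⊕ : {gs : List (Vect k)} {u v : Vect k} → Span gs u → Span gs v → Span gs (u ⊕ v)
  Span-⊕ (nil z) (nil z′) = nil λ c → cong₂ _xor_ (z c) (z′ c)
  Span-⊕ (skip s) (skip t) = skip (Span-⊕ s t)
  Span-⊕ {u = u} {v} (skip s) (take {g = g} t) =
    take (Span-cong (λ c → sym (Bool.xor-assoc (u c) (v c) (g c))) (Span-⊕ s t))
  Span-⊕ {u = u} {v} (take {g = g} s) (skip t) =
    take (Span-cong (λ c → xy∙z≈xz∙y (u c) (g c) (v c)) (Span-⊕ s t))
  Span-⊕ {u = u} {v} (take {g = g} s) (take t) =
    skip (Span-cong (λ c → xor-cancelʳ (u c) (v c) (g c)) (Span-⊕ s t))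

  Span-++ˡ : {gs : List (Vect k)} (hs : List (Vect k)) {v : Vect k} → Span gs v → Span (gs ++ hs) v
  Span-++ˡ hs (nil z)  = Span-zero hs z
  Span-++ˡ hs (skip s) = skip (Span-++ˡ hs s)
  Span-++ˡ hs (take s) = take (Span-++ˡ hs s)

  Span-++ʳ : (gs : List (Vect k)) {hs : List (Vect k)} {v : Vect k} → Span hs v → Span (gs ++ hs) v
  Span-++ʳ []       s = s
  Span-++ʳ (g ∷ gs) s = skip (Span-++ʳ gs s)

  Span-∩ : (C : VSet k) {gs : List (Vect k)} {v : Vect k} → Span gs v → Span (map (C ∩_) gs) (C ∩ v)
  Span-∩ C (nil z)  = nil λ c → trans (cong (C c ∧_) (z c)) (Bool.∧-zeroʳ (C c))
  Span-∩ C (skip s) = skip (Span-∩ C s)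
  Span-∩ C (take s) = take (Span-cong (λ c → Bool.∧-distribˡ-xor (C c) _ _) (Span-∩ C s))

  Span-·-[] : (a : Bool) (g : Vect k) → Span [ g ] (a · g)
  Span-·-[] false g = skip (nil λ c → refl)
  Span-·-[] true  g = take (nil λ c → Bool.xor-same (g c))

  Span-∷⁻ : {g : Vect k} {gs : List (Vect k)} {v : Vect k} →
            Span (g ∷ gs) v → Σ Bool λ a → Span gs (v ⊕ a · g)
  Span-∷⁻ (skip s) = false , Span-cong (λ c → sym (Bool.xor-identityʳ _)) s
  Span-∷⁻ (take s) = true , s

  Span-exchange : {gs : List (Vect k)} {g u w : Vect k} (a : Bool) →
                  Span gs (u ⊕ a · g) → Span gs (w ⊕ g) → Span gs (u ⊕ a · w)
  Span-exchange false s _ = s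
  Span-exchange {g = g} {u} {w} true s t =
    Span-cong (λ c → xor-cancelʳ (u c) (w c) (g c)) (Span-⊕ s t)

  rowList : (Fin m → Vect k) → VSet m → List (Vect k)
  rowList {zero}  f B = []
  rowList {suc m} f B = if B zero then f zero ∷ rest else rest
    where rest = rowList (tail f) (tail B)

  length-rowList : (f : Fin m → Vect k) (B : VSet m) → length (rowList f B) ≡ card B
  length-rowList {zero}  f B = refl
  length-rowList {suc m} f B with B zero
  ... | true  = cong suc (length-rowList (tail f) (tail B))
  ... | false = length-rowList (tail f) (tail B)

  Span-rowList : (f : Fin m → Vect k) (B U : VSet m) → U ⊆ B → Span (rowList f B) (∑ f U)
  Span-rowList {zero}  f B U U⊆B = nil λ c → refl
  Span-rowList {suc m} f B U U⊆B
    with B zero in b₀ | U zero in u₀ | Span-rowList (tail f) (tail B) (tail U) (U⊆B ∘ suc)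
  ... | true  | true  | s = take (Span-cong (λ c → sym (xor-cancelˡ (f zero c) _)) s)
  ... | true  | false | s = skip s
  ... | false | false | s = s
  ... | false | true  | _ = ⊥-elim (true≢false (trans (sym (U⊆B zero u₀)) b₀))

  Dependent-∪⁅⁆⇒Span : (f : Fin m → Vect k) {B : VSet m} {i : Fin m} →
                       Independent f B → Dependent f (B ∪ ⁅ i ⁆) → Span (rowList f B) (f i)
  Dependent-∪⁅⁆⇒Span f {B} {i} ind (U , U⊆B∪i , (j , uj) , zero-sum) with U i in ui
  ... | false = ⊥-elim (true≢false (trans (sym (proj₂ (ind U U⊆B (j , uj)))) (zero-sum _)))
    where
    U⊆B : U ⊆ B
    U⊆B x ux with ∨-≡-true (U⊆B∪i x ux)
    ... | inj₁ bx  = bx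
    ... | inj₂ x≡i = ⊥-elim (true≢false (trans (sym ux) (subst (λ y → U y ≡ false) (sym (≡ᵇ⇒≡ x≡i)) ui)))
  ... | true = Span-cong fi≐ (Span-rowList f B (U ∖ ⁅ i ⁆) U∖i⊆B)
    where
    U∖i⊆B : U ∖ ⁅ i ⁆ ⊆ B
    U∖i⊆B x e with ∧-≡-true e
    ... | ux , x≢i with ∨-≡-true (U⊆B∪i x ux)
    ...   | inj₁ bx  = bx
    ...   | inj₂ x≡i = ⊥-elim (true≢false (trans (sym x≢i) (cong not x≡i)))
    fi≐ : ∑ f (U ∖ ⁅ i ⁆) ≐ f i
    fi≐ c = xor-≡-false (begin
      ∑ f (U ∖ ⁅ i ⁆) c xor f i c        ≡⟨ cong (∑ f (U ∖ ⁅ i ⁆) c xor_) (sym (∑-⁅⁆ f i c)) ⟩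
      ∑ f (U ∖ ⁅ i ⁆) c xor ∑ f ⁅ i ⁆ c  ≡⟨ sym (∑-⊕-sets f (U ∖ ⁅ i ⁆) ⁅ i ⁆ c) ⟩
      ∑ f (U ∖ ⁅ i ⁆ ⊕ ⁅ i ⁆) c          ≡⟨ sym (∑-cong f (∖⁅⁆-⊕⁅⁆ U i ui) c) ⟩
      ∑ f U c                           ≡⟨ zero-sum c ⟩
      false                             ∎)
      where open ≡-Reasoning

  -- The coefficient of g in the given representation of v, and false when none is given.
  headCoeff : {g : Vect k} {gs : List (Vect k)} {v : Vect k} (b : Bool) → (b ≡ true → Span (g ∷ gs) v) → Bool
  headCoeff false _ = false
  headCoeff true  s = proj₁ (Span-∷⁻ (s refl))

  headCoeff-spec : {g : Vect k} {gs : List (Vect k)} {v : Vect k} (b : Bool) (s : b ≡ true → Span (g ∷ gs) v) →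
                   b ≡ true → Span gs (v ⊕ headCoeff b s · g)
  headCoeff-spec true s _ = proj₂ (Span-∷⁻ (s refl))

  Independent-shear : (f : Fin m → Vect k) {T : VSet m} {j : Fin m} (α : Fin m → Bool) →
                      Independent f T → T j ≡ true → Independent (λ i → f i ⊕ α i · f j) (T ∖ ⁅ j ⁆)
  Independent-shear f {T} {j} α ind tj U U⊆T∖j (i , ui) = c , (begin
    ∑ (λ i → f i ⊕ α i · f j) U c        ≡⟨ ∑-⊕-rows f (λ i → α i · f j) U c ⟩
    ∑ f U c xor ∑ (λ i → α i · f j) U c  ≡⟨ cong (∑ f U c xor_) (∑-·-rows α (f j) U c) ⟩
    ∑ f U c xor (p ∧ f j c)              ≡⟨ cong (∑ f U c xor_) (sym (p·fj c)) ⟩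
    ∑ f U c xor ∑ f (p · ⁅ j ⁆) c        ≡⟨ sym (∑-⊕-sets f U (p · ⁅ j ⁆) c) ⟩
    ∑ f U′ c                             ≡⟨ nz ⟩
    true                                 ∎)
    where
    open ≡-Reasoning
    -- The sheared rows over U add up to the original rows over U′ = U ⊕ p · ⁅ j ⁆.
    p = bigXor (U ∩ α)
    U′ = U ⊕ p · ⁅ j ⁆
    p·fj : ∀ c → ∑ f (p · ⁅ j ⁆) c ≡ p ∧ f j c
    p·fj c = trans (∑-·-sets f p ⁅ j ⁆ c) (cong (p ∧_) (∑-⁅⁆ f j c))
    U⊆T : U ⊆ T
    U⊆T x = proj₁ ∘ ∧-≡-true ∘ U⊆T∖j x
    U′⊆T : U′ ⊆ T
    U′⊆T x e with xor-≡-true e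
    ... | inj₁ ux = U⊆T x ux
    ... | inj₂ q  = subst (λ y → T y ≡ true) (sym (≡ᵇ⇒≡ (proj₂ (∧-≡-true q)))) tj
    U′i : U′ i ≡ true
    U′i = trans (cong₂ (λ a b → a xor (p ∧ b)) ui (not-≡-true (proj₂ (∧-≡-true (U⊆T∖j i ui)))))
                (cong (true xor_) (Bool.∧-zeroʳ p))
    nonzero = ind U′ U′⊆T (i , U′i)
    c = proj₁ nonzero
    nz = proj₂ nonzero

  headCoeffs : {g : Vect k} {gs : List (Vect k)} (f : Fin m → Vect k) (T : VSet m) →
               (∀ i → T i ≡ true → Span (g ∷ gs) (f i)) → Fin m → Bool
  headCoeffs f T spans i = headCoeff (T i) (spans i)

  -- Steinitz exchange: if some independent row j uses the head generator g, shearing all rows by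
  -- row j removes g from their representations.
  steinitz : (gs : List (Vect k)) (f : Fin m → Vect k) (T : VSet m) → Independent f T →
             (∀ i → T i ≡ true → Span gs (f i)) → card T ≤ length gs
  steinitz [] f T ind spans with empty⊎nonempty T
  ... | inj₁ empty = ℕ.≤-reflexive (card-empty T empty)
  ... | inj₂ (i , ti) with Independent⇒row-nonzero f ind ti | spans i ti
  ...   | c , nz | nil z = ⊥-elim (true≢false (trans (sym nz) (z c)))
  steinitz (g ∷ gs) f T ind spans with empty⊎nonempty (T ∩ headCoeffs f T spans)
  ... | inj₁ none = ℕ.m≤n⇒m≤1+n (steinitz gs f T ind spans′)
    where
    spans′ : ∀ i → T i ≡ true → Span gs (f i)
    spans′ i ti = Span-cong (λ c → trans (cong (λ a → f i c xor (a ∧ g c)) αi≡false) (Bool.xor-identityʳ _))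
                            (headCoeff-spec (T i) (spans i) ti)
      where
      αi≡false : headCoeffs f T spans i ≡ false
      αi≡false = trans (sym (cong (_∧ headCoeffs f T spans i) ti)) (none i)
  ... | inj₂ (j , tαj) = begin
    card T                  ≡⟨ card-∖⁅⁆ T j tj ⟩
    suc (card (T ∖ ⁅ j ⁆))  ≤⟨ s≤s (steinitz gs _ (T ∖ ⁅ j ⁆) (Independent-shear f α ind tj) spans′) ⟩
    suc (length gs)         ∎
    where
    open ℕ.≤-Reasoning
    α = headCoeffs f T spans
    tj = proj₁ (∧-≡-true tαj)
    fj⊕g : Span gs (f j ⊕ g)
    fj⊕g = Span-cong (λ c → cong (λ a → f j c xor (a ∧ g c)) (proj₂ (∧-≡-true tαj)))
                     (headCoeff-spec (T j) (spans j) tj)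
    spans′ : ∀ i → (T ∖ ⁅ j ⁆) i ≡ true → Span gs (f i ⊕ α i · f j)
    spans′ i t = Span-exchange {g = g} {f i} {f j} (α i)
                   (headCoeff-spec (T i) (spans i) (proj₁ (∧-≡-true t))) fj⊕g

  -- Binary rank

  all⁻ : {A : Set} (p : A → Bool) {xs : List A} → all p xs ≡ true → All (λ x → p x ≡ true) xs
  all⁻ p {[]}     _ = []
  all⁻ p {x ∷ xs} e = proj₁ (∧-≡-true e) ∷ all⁻ p (proj₂ (∧-≡-true e))

  all⁺ : {A : Set} (p : A → Bool) {xs : List A} → All (λ x → p x ≡ true) xs → all p xs ≡ true
  all⁺ p []       = refl
  all⁺ p (e ∷ es) rewrite e = all⁺ p es

  all-≡-false : {A : Set} (p : A → Bool) (xs : List A) → all p xs ≡ false → Any (λ x → p x ≡ false) xs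
  all-≡-false p (x ∷ xs) e with p x in px
  ... | true  = there (all-≡-false p xs e)
  ... | false = here px

  bigOr-≡-true : (f : Fin n → Bool) → bigOr f ≡ true → ∃[ i ] f i ≡ true
  bigOr-≡-true {suc n} f e with f zero in f₀
  ... | true  = zero , f₀
  ... | false with bigOr-≡-true (tail f) e
  ...   | i , fi = suc i , fi

  bigOr-intro : (f : Fin n → Bool) {i : Fin n} → f i ≡ true → bigOr f ≡ true
  bigOr-intro f {zero}  e rewrite e = refl
  bigOr-intro f {suc i} e = ∨-introʳ (f zero) (bigOr-intro (tail f) e)

  bigOr-≡-false : (f : Fin n → Bool) → bigOr f ≡ false → ∀ i → f i ≡ false
  bigOr-≡-false f e i with f i in fi
  ... | true  = ⊥-elim (true≢false (trans (sym (bigOr-intro f fi)) e))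
  ... | false = refl

  module _ {A : Set} (p : A → Bool) (size : A → ℕ) where

    maxOver : List A → ℕ
    maxOver xs = maxList (map size (filterᵇ p xs))

    maxOver-≥ : {s : ℕ} {xs : List A} → Any (λ x → p x ≡ true × s ≤ size x) xs → s ≤ maxOver xs
    maxOver-≥ (here (px , s≤x)) rewrite px = ℕ.≤-trans s≤x (ℕ.m≤m⊔n _ _)
    maxOver-≥ {xs = x ∷ _} (there found) with p x
    ... | true  = ℕ.≤-trans (maxOver-≥ found) (ℕ.m≤n⊔m (size x) _)
    ... | false = maxOver-≥ found

    maxOver-≤ : {k : ℕ} {xs : List A} → All (λ x → p x ≡ true → size x ≤ k) xs → maxOver xs ≤ k
    maxOver-≤ [] = z≤n
    maxOver-≤ {xs = x ∷ _} (bound ∷ bounds) with p x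
    ... | true  = ℕ.⊔-lub (bound refl) (maxOver-≤ bounds)
    ... | false = maxOver-≤ bounds

    maxOver-attained : (xs : List A) → maxOver xs ≡ 0 ⊎ Any (λ x → p x ≡ true × size x ≡ maxOver xs) xs
    maxOver-attained [] = inj₁ refl
    maxOver-attained (x ∷ xs) with p x in px
    ... | false = Sum.map id there (maxOver-attained xs)
    ... | true with ℕ.⊔-sel (size x) (maxOver xs)
    ...   | inj₁ x-max = inj₂ (here (px , sym x-max))
    ...   | inj₂ rest-max with maxOver-attained xs
    ...     | inj₁ zero-max = inj₁ (trans rest-max zero-max)
    ...     | inj₂ found    = inj₂ (there (Any.map (λ (py , e) → py , trans e (sym rest-max)) found))

  rows : (Fin n → Fin n → Bool) → VSet n → Fin n → Vect n
  rows A C i = C ∩ A i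

  ∑-rows : (A : Fin n → Fin n → Bool) (C U : VSet n) → ∑ (rows A C) U ≐ C ∩ rowSum A U
  ∑-rows A C U c = trans (bigXor-cong λ i → ∧-leftComm (U i) (C c) (A i c))
                         (sym (∧-distribˡ-bigXor (C c) λ i → U i ∧ A i c))
    where
    ∧-leftComm : ∀ a b d → a ∧ (b ∧ d) ≡ b ∧ (a ∧ d)
    ∧-leftComm a b d =
      trans (sym (Bool.∧-assoc a b d)) (trans (cong (_∧ d) (Bool.∧-comm a b)) (Bool.∧-assoc b a d))

  module _ (A : Fin n → Fin n → Bool) (C : VSet n) where

    independentRows⇒Independent : {T : VSet n} → independentRows A C T ≡ true → Independent (rows A C) T
    independentRows⇒Independent {T} e U U⊆T (i , ui) = witness (∨-≡-true ok)
      where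
      found = ⊆-subsetsOf T U U⊆T
      S = Any.lookup found
      ok = proj₁ (All.lookupAny (all⁻ _ e) found)
      S≐U = proj₂ (All.lookupAny (all⁻ _ e) found)
      witness : not (bigOr S) ≡ true ⊎ nonzeroComb A C S ≡ true → IsNonzero (∑ (rows A C) U)
      witness (inj₁ S-empty) =
        ⊥-elim (true≢false (trans (sym (bigOr-intro S (trans (S≐U i) ui))) (not-≡-true S-empty)))
      witness (inj₂ nonzero) with bigOr-≡-true (C ∩ rowSum A S) nonzero
      ... | c , e = c , trans (∑-rows A C U c)
                              (trans (cong (C c ∧_) (bigXor-cong λ j → cong (_∧ A j c) (sym (S≐U j)))) e)

    Independent⇒independentRows : {T : VSet n} → Independent (rows A C) T → independentRows A C T ≡ true
    Independent⇒independentRows {T} ind = all⁺ _ (All.map check (subsetsOf-⊆ T))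
      where
      check : {S : VSet n} → S ⊆ T → not (bigOr S) ∨ nonzeroComb A C S ≡ true
      check {S} S⊆T with bigOr S in nonempty
      ... | false = refl
      ... | true with ind S S⊆T (bigOr-≡-true S nonempty)
      ...   | c , nz = bigOr-intro (C ∩ rowSum A S) (trans (sym (∑-rows A C S c)) nz)

    ¬independentRows⇒Dependent : {T : VSet n} → independentRows A C T ≡ false → Dependent (rows A C) T
    ¬independentRows⇒Dependent {T} e =
      S , S⊆T , bigOr-≡-true S (proj₁ fails) , λ c → trans (∑-rows A C S c) (bigOr-≡-false _ (proj₂ fails) c)
      where
      found = all-≡-false _ (subsetsOf T) e
      S = Any.lookup found
      S⊆T = proj₁ (All.lookupAny (subsetsOf-⊆ T) found)
      fails : bigOr S ≡ true × nonzeroComb A C S ≡ false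
      fails = not-∨-≡-false (proj₂ (All.lookupAny (subsetsOf-⊆ T) found))

    binRank-≥ : {X T : VSet n} → T ⊆ X → Independent (rows A C) T → card T ≤ binRank A X C
    binRank-≥ {X} {T} T⊆X ind =
      maxOver-≥ (independentRows A C) card (Any.map candidate (⊆-subsetsOf X T T⊆X))
      where
      candidate : {S : VSet n} → S ≐ T → independentRows A C S ≡ true × card T ≤ card S
      candidate S≐T = Independent⇒independentRows (Independent-mono (rows A C) (≐⇒⊆ S≐T) ind)
                    , ℕ.≤-reflexive (card-cong λ i → sym (S≐T i))

    binRank-≤ : {X : VSet n} {k : ℕ} → (∀ T → T ⊆ X → Independent (rows A C) T → card T ≤ k) →
                binRank A X C ≤ k
    binRank-≤ {X} bound = maxOver-≤ (independentRows A C) card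
      (All.map (λ {T} T⊆X ok → bound T T⊆X (independentRows⇒Independent ok)) (subsetsOf-⊆ X))

    binRank-≤-length : {X : VSet n} (gs : List (Vect n)) → (∀ i → X i ≡ true → Span gs (rows A C i)) →
                       binRank A X C ≤ length gs
    binRank-≤-length gs spans =
      binRank-≤ λ T T⊆X ind → steinitz gs (rows A C) T ind λ i ti → spans i (T⊆X i ti)

    record Basis (X : VSet n) : Set where
      field
        B            : VSet n
        B⊆X          : B ⊆ X
        independent  : Independent (rows A C) B
        card≡binRank : card B ≡ binRank A X C

    basis : (X : VSet n) → Basis X
    basis X with maxOver-attained (independentRows A C) card (subsetsOf X)
    ... | inj₁ rank≡0 = record
      { B            = ∅
      ; B⊆X          = λ _ ()
      ; independent  = λ U U⊆∅ (i , ui) → ⊥-elim (true≢false (sym (U⊆∅ i ui)))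
      ; card≡binRank = trans (card-empty {n} ∅ λ _ → refl) (sym rank≡0)
      }
    ... | inj₂ found = record
      { B            = Any.lookup found
      ; B⊆X          = proj₁ (All.lookupAny (subsetsOf-⊆ X) found)
      ; independent  = independentRows⇒Independent (proj₁ (proj₂ (All.lookupAny (subsetsOf-⊆ X) found)))
      ; card≡binRank = proj₂ (proj₂ (All.lookupAny (subsetsOf-⊆ X) found))
      }

    module _ {X : VSet n} (b : Basis X) where
      open Basis b

      Basis-spans : {i : Fin n} → X i ≡ true → Span (rowList (rows A C) B) (rows A C i)
      Basis-spans {i} xi with B i in bi
      ... | true = Span-cong (∑-⁅⁆ (rows A C) i) (Span-rowList (rows A C) B ⁅ i ⁆ (⁅⁆-⊆ bi))
      ... | false with independentRows A C (B ∪ ⁅ i ⁆) in indep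
      ...   | false = Dependent-∪⁅⁆⇒Span (rows A C) independent (¬independentRows⇒Dependent indep)
      ...   | true = ⊥-elim (ℕ.<-irrefl refl (begin-strict
        binRank A X C     ≡⟨ sym card≡binRank ⟩
        card B            <⟨ ℕ.n<1+n (card B) ⟩
        suc (card B)      ≡⟨ sym (card-∪⁅⁆ B i bi) ⟩
        card (B ∪ ⁅ i ⁆)  ≤⟨ binRank-≥ B∪i⊆X (independentRows⇒Independent indep) ⟩
        binRank A X C     ∎))
        where
        open ℕ.≤-Reasoning
        B∪i⊆X : B ∪ ⁅ i ⁆ ⊆ X
        B∪i⊆X x e with ∨-≡-true e
        ... | inj₁ bx  = B⊆X x bx
        ... | inj₂ x≡i = subst (λ y → X y ≡ true) (sym (≡ᵇ⇒≡ x≡i)) xi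

  binRank-mono : {A A′ : Fin n → Fin n → Bool} {X X′ C C′ : VSet n} →
                 (∀ i → A i ≐ A′ i) → X ⊆ X′ → C ≐ C′ → binRank A X C ≤ binRank A′ X′ C′
  binRank-mono {A = A} {A′} {C = C} {C′} A≐A′ X⊆X′ C≐C′ = binRank-≤ A C λ T T⊆X ind →
    binRank-≥ A′ C′ (λ i → X⊆X′ i ∘ T⊆X i) (Independent-cong (λ i c → cong₂ _∧_ (C≐C′ c) (A≐A′ i c)) ind)

  _≈_ : Graph n → Graph n → Set
  G ≈ G′ = V G ≐ V G′ × (∀ u → adj G u ≐ adj G′ u)

  ρ-cong : {G G′ : Graph n} {S S′ : VSet n} → G ≈ G′ → S ≐ S′ → ρ G S ≡ ρ G′ S′
  ρ-cong {G = G} {G′} {S} {S′} (V≐ , adj≐) S≐S′ = ℕ.≤-antisym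
    (binRank-mono adj≐ (≐⇒⊆ S≐S′) cols≐)
    (binRank-mono (λ u c → sym (adj≐ u c)) (≐⇒⊆ (sym ∘ S≐S′)) (sym ∘ cols≐))
    where
    cols≐ : V G ∖ S ≐ V G′ ∖ S′
    cols≐ c = cong₂ (λ a b → a ∧ not b) (V≐ c) (S≐S′ c)

  adj⇒V : (H : Graph n) {u w : Fin n} → adj H u w ≡ true → V H w ≡ true
  adj⇒V H = proj₂ ∘ closed H _ _

  adj-outside : (H : Graph n) {u w : Fin n} → V H w ≡ false → adj H u w ≡ false
  adj-outside H {u} {w} vw with adj H u w in a
  ... | true  = ⊥-elim (true≢false (trans (sym (adj⇒V H a)) vw))
  ... | false = refl

  ρ-empty : (H : Graph n) {S : VSet n} → S ≐ ∅ → ρ H S ≡ 0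
  ρ-empty H {S} S≐∅ = ℕ.n≤0⇒n≡0 (binRank-≤-length (adj H) (V H ∖ S) [] λ i si →
    ⊥-elim (true≢false (trans (sym si) (S≐∅ i))))

  ρ-full : (H : Graph n) {S : VSet n} → S ≐ V H → ρ H S ≡ 0
  ρ-full H {S} S≐V = ℕ.n≤0⇒n≡0 (binRank-≤-length (adj H) (V H ∖ S) [] λ i _ →
    nil λ c → no-columns c (adj H i c))
    where
    no-columns : ∀ c a → (V H c ∧ not (S c)) ∧ a ≡ false
    no-columns c a rewrite S≐V c with V H c
    ... | true  = refl
    ... | false = refl

  ρ-spanning : (H : Graph n) (S C : VSet n) → (∀ c → C c ≡ true → S c ≡ false) →
               Σ (List (Vect n)) λ gs → length gs ≡ ρ H (S ∩ V H) × (∀ i → S i ≡ true → Span gs (C ∩ adj H i))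
  ρ-spanning H S C C∩S≡∅ = map (C ∩_) (rowList (rows (adj H) Cₕ) B) , length≡ρ , spans
    where
    Cₕ = V H ∖ (S ∩ V H)
    b = basis (adj H) Cₕ (S ∩ V H)
    open Basis b
    length≡ρ = trans (List.length-map (C ∩_) (rowList (rows (adj H) Cₕ) B))
                     (trans (length-rowList (rows (adj H) Cₕ) B) card≡binRank)
    restrict : ∀ i → C ∩ rows (adj H) Cₕ i ≐ C ∩ adj H i
    restrict i c with adj H i c in a | C c in cc
    ... | false | w     = cong (w ∧_) (Bool.∧-zeroʳ _)
    ... | true  | false = refl
    ... | true  | true  rewrite C∩S≡∅ c cc | adj⇒V H a = refl
    spans : ∀ i → S i ≡ true → Span (map (C ∩_) (rowList (rows (adj H) Cₕ) B)) (C ∩ adj H i)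
    spans i si with V H i in vi
    ... | true  = Span-cong (restrict i) (Span-∩ C (Basis-spans (adj H) Cₕ b (∧-intro si vi)))
    ... | false = Span-zero _ λ c →
      trans (cong (C c ∧_) (trans (Graph.sym H i c) (adj-outside H vi))) (Bool.∧-zeroʳ (C c))

  ρ-△-≤ : (G₁ G₂ : Graph n) (S : VSet n) → ρ (G₁ △ G₂) S ≤ ρ G₁ (S ∩ V G₁) + ρ G₂ (S ∩ V G₂)
  ρ-△-≤ G₁ G₂ S =
    let (gs₁ , length₁ , spans₁) = ρ-spanning G₁ S C C∩S≡∅
        (gs₂ , length₂ , spans₂) = ρ-spanning G₂ S C C∩S≡∅
    in begin
    ρ (G₁ △ G₂) S                      ≤⟨ binRank-≤-length (adj (G₁ △ G₂)) C (gs₁ ++ gs₂) (λ i si →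
                                            Span-cong (λ c → sym (Bool.∧-distribˡ-xor (C c) _ _))
                                              (Span-⊕ (Span-++ˡ gs₂ (spans₁ i si)) (Span-++ʳ gs₁ (spans₂ i si)))) ⟩
    length (gs₁ ++ gs₂)                ≡⟨ List.length-++ gs₁ ⟩
    length gs₁ + length gs₂            ≡⟨ cong₂ _+_ length₁ length₂ ⟩
    ρ G₁ (S ∩ V G₁) + ρ G₂ (S ∩ V G₂)  ∎
    where
    open ℕ.≤-Reasoning
    C = V (G₁ △ G₂) ∖ S
    C∩S≡∅ : ∀ c → C c ≡ true → S c ≡ false
    C∩S≡∅ c = not-≡-true ∘ proj₂ ∘ ∧-≡-true

  IsPart : Graph n → Graph n → Set
  IsPart Gₐ G = V Gₐ ⊆ V G × (∀ j c → V Gₐ c ≡ true → adj G j c ≡ adj Gₐ j c)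

  ∑-rows-part : {Gₐ G : Graph n} → IsPart Gₐ G → (S U : VSet n) {c : Fin n} → V Gₐ c ≡ true →
                ∑ (rows (adj G) (V G ∖ S)) U c ≡ ∑ (rows (adj Gₐ) (V Gₐ ∖ (S ∩ V Gₐ))) (U ∩ V Gₐ) c
  ∑-rows-part {Gₐ = Gₐ} {G} (V⊆ , adj≡) S U {c} vc = begin
    ∑ (rows (adj G) (V G ∖ S)) U c
      ≡⟨ ∑-rows (adj G) (V G ∖ S) U c ⟩
    (V G c ∧ not (S c)) ∧ rowSum (adj G) U c
      ≡⟨ cong₂ _∧_ cols (bigXor-cong entries) ⟩
    (V Gₐ c ∧ not (S c ∧ V Gₐ c)) ∧ rowSum (adj Gₐ) (U ∩ V Gₐ) c
      ≡⟨ sym (∑-rows (adj Gₐ) (V Gₐ ∖ (S ∩ V Gₐ)) (U ∩ V Gₐ) c) ⟩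
    ∑ (rows (adj Gₐ) (V Gₐ ∖ (S ∩ V Gₐ))) (U ∩ V Gₐ) c
      ∎
    where
    open ≡-Reasoning
    cols : V G c ∧ not (S c) ≡ V Gₐ c ∧ not (S c ∧ V Gₐ c)
    cols rewrite vc | V⊆ c vc | Bool.∧-identityʳ (S c) = refl
    entries : ∀ j → U j ∧ adj G j c ≡ (U j ∧ V Gₐ j) ∧ adj Gₐ j c
    entries j rewrite adj≡ j c vc with adj Gₐ j c in a
    ... | false = trans (Bool.∧-zeroʳ (U j)) (sym (Bool.∧-zeroʳ _))
    ... | true  rewrite proj₁ (closed Gₐ j c a) = sym (Bool.∧-identityʳ (U j ∧ true))

  IsPart-nonzero : {Gₐ G : Graph n} → IsPart Gₐ G → (S U B : VSet n) →
                   Independent (rows (adj Gₐ) (V Gₐ ∖ (S ∩ V Gₐ))) B → U ∩ V Gₐ ⊆ B → Nonempty (U ∩ V Gₐ) →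
                   IsNonzero (∑ (rows (adj G) (V G ∖ S)) U)
  IsPart-nonzero {Gₐ = Gₐ} {G} part S U B ind U∩V⊆B ne with ind (U ∩ V Gₐ) U∩V⊆B ne
  ... | c , nz = c , trans (∑-rows-part {Gₐ = Gₐ} {G} part S U vc) nz
    where
    vc : V Gₐ c ≡ true
    vc = proj₁ (∧-≡-true (proj₁ (∧-≡-true
           (trans (sym (∑-rows (adj Gₐ) (V Gₐ ∖ (S ∩ V Gₐ)) (U ∩ V Gₐ) c)) nz))))

  module _ (G₁ G₂ : Graph n) (disjoint : V G₁ ∩ V G₂ ≐ ∅) where

    disjoint-∉ : {u : Fin n} → V G₁ u ≡ true → V G₂ u ≡ false
    disjoint-∉ {u} v₁ = trans (sym (cong (_∧ V G₂ u) v₁)) (disjoint u)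

    disjoint-∉′ : {u : Fin n} → V G₂ u ≡ true → V G₁ u ≡ false
    disjoint-∉′ {u} v₂ with V G₁ u in v₁
    ... | true  = ⊥-elim (true≢false (trans (sym v₂) (disjoint-∉ v₁)))
    ... | false = refl

    △-partˡ : IsPart G₁ (G₁ △ G₂)
    △-partˡ = (λ u → ∨-introˡ (V G₂ u))
            , λ j c v₁ → trans (cong (adj G₁ j c xor_) (adj-outside G₂ (disjoint-∉ v₁))) (Bool.xor-identityʳ _)

    △-partʳ : IsPart G₂ (G₁ △ G₂)
    △-partʳ = (λ u → ∨-introʳ (V G₁ u))
            , λ j c v₂ → cong (_xor adj G₂ j c) (adj-outside G₁ (disjoint-∉′ v₂))

    Independent-∪ : (S : VSet n) {B₁ B₂ : VSet n} → B₁ ⊆ V G₁ → B₂ ⊆ V G₂ →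
                    Independent (rows (adj G₁) (V G₁ ∖ (S ∩ V G₁))) B₁ →
                    Independent (rows (adj G₂) (V G₂ ∖ (S ∩ V G₂))) B₂ →
                    Independent (rows (adj (G₁ △ G₂)) (V (G₁ △ G₂) ∖ S)) (B₁ ∪ B₂)
    Independent-∪ S {B₁} {B₂} B₁⊆V₁ B₂⊆V₂ ind₁ ind₂ U U⊆B (i , ui) with ∨-≡-true (U⊆B i ui)
    ... | inj₁ b₁i =
      IsPart-nonzero {Gₐ = G₁} {G₁ △ G₂} △-partˡ S U B₁ ind₁ U∩V₁⊆B₁ (i , ∧-intro ui (B₁⊆V₁ i b₁i))
      where
      U∩V₁⊆B₁ : U ∩ V G₁ ⊆ B₁
      U∩V₁⊆B₁ x e with ∧-≡-true e
      ... | ux , v₁x with ∨-≡-true (U⊆B x ux)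
      ...   | inj₁ b₁x = b₁x
      ...   | inj₂ b₂x = ⊥-elim (true≢false (trans (sym (B₂⊆V₂ x b₂x)) (disjoint-∉ v₁x)))
    ... | inj₂ b₂i =
      IsPart-nonzero {Gₐ = G₂} {G₁ △ G₂} △-partʳ S U B₂ ind₂ U∩V₂⊆B₂ (i , ∧-intro ui (B₂⊆V₂ i b₂i))
      where
      U∩V₂⊆B₂ : U ∩ V G₂ ⊆ B₂
      U∩V₂⊆B₂ x e with ∧-≡-true e
      ... | ux , v₂x with ∨-≡-true (U⊆B x ux)
      ...   | inj₂ b₂x = b₂x
      ...   | inj₁ b₁x = ⊥-elim (true≢false (trans (sym (B₁⊆V₁ x b₁x)) (disjoint-∉′ v₂x)))

    ρ-△-≥ : (S : VSet n) → ρ G₁ (S ∩ V G₁) + ρ G₂ (S ∩ V G₂) ≤ ρ (G₁ △ G₂) S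
    ρ-△-≥ S = begin
      ρ G₁ (S ∩ V G₁) + ρ G₂ (S ∩ V G₂)  ≡⟨ sym (cong₂ _+_ b₁.card≡binRank b₂.card≡binRank) ⟩
      card b₁.B + card b₂.B              ≡⟨ sym (card-∪-disjoint b₁.B b₂.B B-disjoint) ⟩
      card (b₁.B ∪ b₂.B)                 ≤⟨ binRank-≥ (adj (G₁ △ G₂)) (V (G₁ △ G₂) ∖ S) B⊆S
                                             (Independent-∪ S B₁⊆V₁ B₂⊆V₂ b₁.independent b₂.independent) ⟩
      ρ (G₁ △ G₂) S                      ∎
      where
      open ℕ.≤-Reasoning
      module b₁ = Basis (basis (adj G₁) (V G₁ ∖ (S ∩ V G₁)) (S ∩ V G₁))
      module b₂ = Basis (basis (adj G₂) (V G₂ ∖ (S ∩ V G₂)) (S ∩ V G₂))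
      B₁⊆V₁ : b₁.B ⊆ V G₁
      B₁⊆V₁ i = proj₂ ∘ ∧-≡-true ∘ b₁.B⊆X i
      B₂⊆V₂ : b₂.B ⊆ V G₂
      B₂⊆V₂ i = proj₂ ∘ ∧-≡-true ∘ b₂.B⊆X i
      B-disjoint : b₁.B ∩ b₂.B ≐ ∅
      B-disjoint i with b₁.B i in b₁i | b₂.B i in b₂i
      ... | false | _     = refl
      ... | true  | false = refl
      ... | true  | true  = ⊥-elim (true≢false (trans (sym (B₂⊆V₂ i b₂i)) (disjoint-∉ (B₁⊆V₁ i b₁i))))
      B⊆S : b₁.B ∪ b₂.B ⊆ S
      B⊆S i e with ∨-≡-true e
      ... | inj₁ b₁i = proj₁ (∧-≡-true (b₁.B⊆X i b₁i))
      ... | inj₂ b₂i = proj₁ (∧-≡-true (b₂.B⊆X i b₂i))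

  -- Sums over all subsets

  sumSubsets : VSet n → (VSet n → ℕ) → ℕ
  sumSubsets X F = sum (map F (subsetsOf X))

  sumSubsets-cong : (X : VSet n) {F F′ : VSet n → ℕ} → (∀ S → F S ≡ F′ S) →
                    sumSubsets X F ≡ sumSubsets X F′
  sumSubsets-cong X F≗F′ = cong sum (List.map-cong F≗F′ (subsetsOf X))

  sumSubsets-mono : (X : VSet n) {F F′ : VSet n → ℕ} → (∀ S → F S ≤ F′ S) →
                    sumSubsets X F ≤ sumSubsets X F′
  sumSubsets-mono X {F} {F′} F≤F′ = go (subsetsOf X)
    where
    go : (Ss : List (VSet _)) → sum (map F Ss) ≤ sum (map F′ Ss)
    go []       = z≤n
    go (S ∷ Ss) = ℕ.+-mono-≤ (F≤F′ S) (go Ss)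

  sumSubsets-+ : (X : VSet n) (F F′ : VSet n → ℕ) →
                 sumSubsets X (λ S → F S + F′ S) ≡ sumSubsets X F + sumSubsets X F′
  sumSubsets-+ X F F′ = go (subsetsOf X)
    where
    go : (Ss : List (VSet _)) → sum (map (λ S → F S + F′ S) Ss) ≡ sum (map F Ss) + sum (map F′ Ss)
    go []       = refl
    go (S ∷ Ss) = trans (cong (F S + F′ S +_) (go Ss)) (+-interchange (F S) (F′ S) _ _)

  sumSubsets-true : (X : VSet (suc n)) (F : VSet (suc n) → ℕ) → X zero ≡ true →
                    sumSubsets X F ≡ sumSubsets (tail X) (F ∘ consB false) + sumSubsets (tail X) (F ∘ consB true)
  sumSubsets-true X F x₀ rewrite x₀ = begin
    sum (map F (map (consB false) R ++ map (consB true) R))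
      ≡⟨ cong sum (List.map-++ F (map (consB false) R) _) ⟩
    sum (map F (map (consB false) R) ++ map F (map (consB true) R))
      ≡⟨ sum-++ (map F (map (consB false) R)) _ ⟩
    sum (map F (map (consB false) R)) + sum (map F (map (consB true) R))
      ≡⟨ sym (cong₂ (λ xs ys → sum xs + sum ys) (List.map-∘ R) (List.map-∘ R)) ⟩
    sum (map (F ∘ consB false) R) + sum (map (F ∘ consB true) R)
      ∎
    where
    open ≡-Reasoning
    R = subsetsOf (tail X)

  sumSubsets-false : (X : VSet (suc n)) (F : VSet (suc n) → ℕ) → X zero ≡ false →
                     sumSubsets X F ≡ sumSubsets (tail X) (F ∘ consB false)
  sumSubsets-false X F x₀ rewrite x₀ = cong sum (sym (List.map-∘ (subsetsOf (tail X))))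

  Respects≐ : (VSet n → ℕ) → Set
  Respects≐ F = ∀ {S T} → S ≐ T → F S ≡ F T

  private
    double-+ : ∀ p q a₀ a₁ b₀ b₁ → p * a₀ ≡ q * b₀ → p * a₁ ≡ q * b₁ →
               2 * p * (a₀ + a₁) ≡ 2 * q * (b₀ + b₁)
    double-+ p q a₀ a₁ b₀ b₁ e₀ e₁ = begin
      2 * p * (a₀ + a₁)      ≡⟨ distribute p a₀ a₁ ⟩
      2 * (p * a₀ + p * a₁)  ≡⟨ cong (2 *_) (cong₂ _+_ e₀ e₁) ⟩
      2 * (q * b₀ + q * b₁)  ≡⟨ sym (distribute q b₀ b₁) ⟩
      2 * q * (b₀ + b₁)      ∎
      where
      open ≡-Reasoning
      distribute : ∀ r c d → 2 * r * (c + d) ≡ 2 * (r * c + r * d)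
      distribute = solve-∀

    double : ∀ p q a b → p * a ≡ q * b → p * (a + a) ≡ 2 * q * b
    double p q a b e = begin
      p * (a + a)    ≡⟨ ℕ.*-distribˡ-+ p a a ⟩
      p * a + p * a  ≡⟨ cong₂ _+_ e e ⟩
      q * b + q * b  ≡⟨ twice q b ⟩
      2 * q * b      ∎
      where
      open ≡-Reasoning
      twice : ∀ r s → r * s + r * s ≡ 2 * r * s
      twice = solve-∀

  -- Each S ⊆ X is S′ ∩ X for exactly 2^(|Y| - |X|) sets S′ ⊆ Y.
  sumSubsets-∩ : (X Y : VSet n) → X ⊆ Y → (F : VSet n → ℕ) → Respects≐ F →
                 2 ^ card X * sumSubsets Y (λ S → F (S ∩ X)) ≡ 2 ^ card Y * sumSubsets X F
  sumSubsets-∩ {zero}  X Y _ F resp = cong (λ s → 1 * (s + 0)) (resp λ ())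
  sumSubsets-∩ {suc n} X Y X⊆Y F resp = cases (X zero) (Y zero) refl refl
    where
    open ≡-Reasoning
    X′ = tail X
    Y′ = tail Y
    F₀ = F ∘ consB false
    F₁ = F ∘ consB true
    IH : ∀ b → 2 ^ card X′ * sumSubsets Y′ (λ S → F (consB b (S ∩ X′))) ≡
               2 ^ card Y′ * sumSubsets X′ (F ∘ consB b)
    IH b = sumSubsets-∩ X′ Y′ (X⊆Y ∘ suc) (F ∘ consB b) (resp ∘ consB-cong b)
    restrict : ∀ {a} → X zero ≡ a → ∀ b →
               sumSubsets Y′ (λ S → F (consB b S ∩ X)) ≡ sumSubsets Y′ (λ S → F (consB (b ∧ a) (S ∩ X′)))
    restrict x₀ b = sumSubsets-cong Y′ λ S → resp (consB-∩ b S x₀)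
    cases : ∀ a b → X zero ≡ a → Y zero ≡ b →
            2 ^ card X * sumSubsets Y (λ S → F (S ∩ X)) ≡ 2 ^ card Y * sumSubsets X F
    cases true  false x₀ y₀ = ⊥-elim (true≢false (trans (sym (X⊆Y zero x₀)) y₀))
    cases true  true  x₀ y₀ = begin
      2 ^ card X * sumSubsets Y (λ S → F (S ∩ X))
        ≡⟨ cong₂ _*_ (cong (2 ^_) (card-tail X x₀))
                     (trans (sumSubsets-true Y _ y₀) (cong₂ _+_ (restrict x₀ false) (restrict x₀ true))) ⟩
      2 * 2 ^ card X′ * (sumSubsets Y′ (λ S → F₀ (S ∩ X′)) + sumSubsets Y′ (λ S → F₁ (S ∩ X′)))
        ≡⟨ double-+ (2 ^ card X′) (2 ^ card Y′) _ _ _ _ (IH false) (IH true) ⟩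
      2 * 2 ^ card Y′ * (sumSubsets X′ F₀ + sumSubsets X′ F₁)
        ≡⟨ sym (cong₂ _*_ (cong (2 ^_) (card-tail Y y₀)) (sumSubsets-true X F x₀)) ⟩
      2 ^ card Y * sumSubsets X F
        ∎
    cases false true  x₀ y₀ = begin
      2 ^ card X * sumSubsets Y (λ S → F (S ∩ X))
        ≡⟨ cong₂ _*_ (cong (2 ^_) (card-tail X x₀))
                     (trans (sumSubsets-true Y _ y₀) (cong₂ _+_ (restrict x₀ false) (restrict x₀ true))) ⟩
      2 ^ card X′ * (sumSubsets Y′ (λ S → F₀ (S ∩ X′)) + sumSubsets Y′ (λ S → F₀ (S ∩ X′)))
        ≡⟨ double (2 ^ card X′) (2 ^ card Y′) _ _ (IH false) ⟩
      2 * 2 ^ card Y′ * sumSubsets X′ F₀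
        ≡⟨ sym (cong₂ _*_ (cong (2 ^_) (card-tail Y y₀)) (sumSubsets-false X F x₀)) ⟩
      2 ^ card Y * sumSubsets X F
        ∎
    cases false false x₀ y₀ = begin
      2 ^ card X * sumSubsets Y (λ S → F (S ∩ X))
        ≡⟨ cong₂ _*_ (cong (2 ^_) (card-tail X x₀)) (trans (sumSubsets-false Y _ y₀) (restrict x₀ false)) ⟩
      2 ^ card X′ * sumSubsets Y′ (λ S → F₀ (S ∩ X′))
        ≡⟨ IH false ⟩
      2 ^ card Y′ * sumSubsets X′ F₀
        ≡⟨ sym (cong₂ _*_ (cong (2 ^_) (card-tail Y y₀)) (sumSubsets-false X F x₀)) ⟩
      2 ^ card Y * sumSubsets X F
        ∎

  VanishesAt : (VSet n → ℕ) → VSet n → Set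
  VanishesAt F Z = ∀ S → S ≐ Z → F S ≡ 0

  VanishesAt-consB : {F : VSet (suc n) → ℕ} {Z : VSet (suc n)} {b : Bool} →
                     VanishesAt F Z → Z zero ≡ b → VanishesAt (F ∘ consB b) (tail Z)
  VanishesAt-consB vanishes z₀ S S≐Z′ = vanishes _ (consB-≐ z₀ S≐Z′)

  private
    +-≤-double : ∀ {a b p} → a ≤ p → b ≤ p → a + b ≤ 2 * p
    +-≤-double {p = p} a≤p b≤p = ℕ.+-mono-≤ a≤p (ℕ.≤-trans b≤p (ℕ.≤-reflexive (sym (ℕ.+-identityʳ p))))

    +-suc-≤-double : ∀ {a b p} → a ≤ p → suc b ≤ p → suc (a + b) ≤ 2 * p
    +-suc-≤-double {a} {b} a≤p sb≤p = ℕ.≤-trans (ℕ.≤-reflexive (sym (ℕ.+-suc a b))) (+-≤-double a≤p sb≤p)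

  sumSubsets-≤ : (X : VSet n) (F : VSet n → ℕ) → (∀ S → F S ≤ 1) → sumSubsets X F ≤ 2 ^ card X
  sumSubsets-≤ {zero}  X F F≤1 = ℕ.≤-trans (ℕ.≤-reflexive (ℕ.+-identityʳ _)) (F≤1 _)
  sumSubsets-≤ {suc n} X F F≤1 = cases (X zero) refl
    where
    open ℕ.≤-Reasoning
    X′ = tail X
    half : ∀ b → sumSubsets X′ (F ∘ consB b) ≤ 2 ^ card X′
    half b = sumSubsets-≤ X′ (F ∘ consB b) (F≤1 ∘ consB b)
    cases : ∀ a → X zero ≡ a → sumSubsets X F ≤ 2 ^ card X
    cases true x₀ = begin
      sumSubsets X F                                                    ≡⟨ sumSubsets-true X F x₀ ⟩
      sumSubsets X′ (F ∘ consB false) + sumSubsets X′ (F ∘ consB true)  ≤⟨ +-≤-double (half false) (half true) ⟩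
      2 * 2 ^ card X′                                                   ≡⟨ cong (2 ^_) (sym (card-tail X x₀)) ⟩
      2 ^ card X                                                        ∎
    cases false x₀ = begin
      sumSubsets X F                   ≡⟨ sumSubsets-false X F x₀ ⟩
      sumSubsets X′ (F ∘ consB false)  ≤⟨ half false ⟩
      2 ^ card X′                      ≡⟨ cong (2 ^_) (sym (card-tail X x₀)) ⟩
      2 ^ card X                       ∎

  sumSubsets-<-vanishing : (X Z : VSet n) (F : VSet n → ℕ) → (∀ S → F S ≤ 1) → Z ⊆ X → VanishesAt F Z →
                           sumSubsets X F < 2 ^ card X
  sumSubsets-<-vanishing {zero}  X Z F F≤1 Z⊆X vanishes =
    s≤s (ℕ.≤-reflexive (trans (ℕ.+-identityʳ _) (vanishes _ λ ())))
  sumSubsets-<-vanishing {suc n} X Z F F≤1 Z⊆X vanishes = cases (X zero) (Z zero) refl refl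
    where
    open ℕ.≤-Reasoning
    X′ = tail X
    half : ∀ b → sumSubsets X′ (F ∘ consB b) ≤ 2 ^ card X′
    half b = sumSubsets-≤ X′ (F ∘ consB b) (F≤1 ∘ consB b)
    vanishing-half : ∀ {b} → Z zero ≡ b → sumSubsets X′ (F ∘ consB b) < 2 ^ card X′
    vanishing-half z₀ =
      sumSubsets-<-vanishing X′ (tail Z) _ (F≤1 ∘ consB _) (Z⊆X ∘ suc) (VanishesAt-consB vanishes z₀)
    cases : ∀ a b → X zero ≡ a → Z zero ≡ b → sumSubsets X F < 2 ^ card X
    cases false true  x₀ z₀ = ⊥-elim (true≢false (trans (sym (Z⊆X zero z₀)) x₀))
    cases false false x₀ z₀ = begin-strict
      sumSubsets X F                   ≡⟨ sumSubsets-false X F x₀ ⟩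
      sumSubsets X′ (F ∘ consB false)  <⟨ vanishing-half z₀ ⟩
      2 ^ card X′                      ≡⟨ cong (2 ^_) (sym (card-tail X x₀)) ⟩
      2 ^ card X                       ∎
    cases true true x₀ z₀ = begin-strict
      sumSubsets X F
        ≡⟨ sumSubsets-true X F x₀ ⟩
      sumSubsets X′ (F ∘ consB false) + sumSubsets X′ (F ∘ consB true)
        <⟨ +-suc-≤-double (half false) (vanishing-half z₀) ⟩
      2 * 2 ^ card X′
        ≡⟨ cong (2 ^_) (sym (card-tail X x₀)) ⟩
      2 ^ card X
        ∎
    cases true false x₀ z₀ = begin-strict
      sumSubsets X F
        ≡⟨ sumSubsets-true X F x₀ ⟩
      sumSubsets X′ (F ∘ consB false) + sumSubsets X′ (F ∘ consB true)
        ≡⟨ ℕ.+-comm (sumSubsets X′ (F ∘ consB false)) _ ⟩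
      sumSubsets X′ (F ∘ consB true) + sumSubsets X′ (F ∘ consB false)
        <⟨ +-suc-≤-double (half true) (vanishing-half z₀) ⟩
      2 * 2 ^ card X′
        ≡⟨ cong (2 ^_) (sym (card-tail X x₀)) ⟩
      2 ^ card X
        ∎

  sumSubsets-+2-≤ : (X : VSet n) (F : VSet n → ℕ) → (∀ S → F S ≤ 1) → Nonempty X →
                    VanishesAt F ∅ → VanishesAt F X → 2 + sumSubsets X F ≤ 2 ^ card X
  sumSubsets-+2-≤ {suc n} X F F≤1 (j , xj) vanishes-∅ vanishes-X = cases (X zero) j refl xj
    where
    open ℕ.≤-Reasoning
    X′ = tail X
    cases : ∀ a j → X zero ≡ a → X j ≡ true → 2 + sumSubsets X F ≤ 2 ^ card X
    cases false zero    x₀ xj = ⊥-elim (true≢false (trans (sym xj) x₀))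
    cases false (suc j) x₀ xj = begin
      2 + sumSubsets X F                   ≡⟨ cong (2 +_) (sumSubsets-false X F x₀) ⟩
      2 + sumSubsets X′ (F ∘ consB false)  ≤⟨ sumSubsets-+2-≤ X′ (F ∘ consB false) (F≤1 ∘ consB false) (j , xj)
                                                (VanishesAt-consB vanishes-∅ refl) (VanishesAt-consB vanishes-X x₀) ⟩
      2 ^ card X′                          ≡⟨ cong (2 ^_) (sym (card-tail X x₀)) ⟩
      2 ^ card X                           ∎
    cases true _ x₀ _ = begin
      2 + sumSubsets X F  ≡⟨ cong (2 +_) (sumSubsets-true X F x₀) ⟩
      suc (suc (s₀ + s₁))  ≡⟨ cong suc (sym (ℕ.+-suc s₀ s₁)) ⟩
      suc s₀ + suc s₁      ≤⟨ +-≤-double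
        (sumSubsets-<-vanishing X′ ∅ _ (F≤1 ∘ consB false) (λ _ ()) (VanishesAt-consB vanishes-∅ refl))
        (sumSubsets-<-vanishing X′ X′ _ (F≤1 ∘ consB true) (λ _ → id) (VanishesAt-consB vanishes-X x₀)) ⟩
      2 * 2 ^ card X′      ≡⟨ cong (2 ^_) (sym (card-tail X x₀)) ⟩
      2 ^ card X           ∎
      where
      s₀ = sumSubsets X′ (F ∘ consB false)
      s₁ = sumSubsets X′ (F ∘ consB true)

  star : Graph n → Fin n → Graph n
  star G v = record
    { V      = λ u → (u ≡ᵇ v) ∨ adj G v u
    ; adj    = λ u w → ((u ≡ᵇ v) ∧ adj G v w) ∨ ((w ≡ᵇ v) ∧ adj G u v)
    ; sym    = λ u w → trans (cong₂ (λ a b → ((u ≡ᵇ v) ∧ a) ∨ ((w ≡ᵇ v) ∧ b)) (Graph.sym G v w) (Graph.sym G u v))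
                             (Bool.∨-comm ((u ≡ᵇ v) ∧ adj G w v) ((w ≡ᵇ v) ∧ adj G v u))
    ; irrefl = irrefl′
    ; closed = closed′
    }
    where
    irrefl′ : ∀ u → ((u ≡ᵇ v) ∧ adj G v u) ∨ ((u ≡ᵇ v) ∧ adj G u v) ≡ false
    irrefl′ u with u ≟ v
    ... | yes refl rewrite irrefl G u = refl
    ... | no  _    = refl
    closed′ : ∀ u w → ((u ≡ᵇ v) ∧ adj G v w) ∨ ((w ≡ᵇ v) ∧ adj G u v) ≡ true →
              ((u ≡ᵇ v) ∨ adj G v u ≡ true) × ((w ≡ᵇ v) ∨ adj G v w ≡ true)
    closed′ u w e with u ≟ v | w ≟ v
    ... | yes refl | yes refl = refl , refl
    ... | yes refl | no  _    = refl , trans (sym (Bool.∨-identityʳ _)) e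
    ... | no  _    | yes refl = trans (Graph.sym G w u) e , refl
    ... | no  _    | no  _    = ⊥-elim (true≢false (sym e))

  module _ (G : Graph n) (v : Fin n) where

    card-star : card (V (star G v)) ≡ suc (deg G v)
    card-star = trans (card-cong λ u → Bool.∨-comm (u ≡ᵇ v) (adj G v u)) (card-∪⁅⁆ (adj G v) v (irrefl G v))

    star-⊆ : V G v ≡ true → V (star G v) ⊆ V G
    star-⊆ v∈G u e with ∨-≡-true e
    ... | inj₁ u≡v = subst (λ x → V G x ≡ true) (sym (≡ᵇ⇒≡ u≡v)) v∈G
    ... | inj₂ a   = adj⇒V G a

    star-nonempty : Nonempty (V (star G v))
    star-nonempty = v , ∨-introˡ _ (≡ᵇ-refl v)

    －-△-star : V G v ≡ true → G ≈ (G － v) △ star G v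
    －-△-star v∈G = V≐ , adj≐
      where
      V≐ : V G ≐ V ((G － v) △ star G v)
      V≐ u with u ≟ v | adj G v u in a
      ... | yes refl | _     = trans v∈G (sym (Bool.∨-zeroʳ _))
      ... | no  _    | true  = trans (adj⇒V G a) (sym (Bool.∨-zeroʳ _))
      ... | no  _    | false = sym (trans (Bool.∨-identityʳ _) (Bool.∧-identityʳ (V G u)))
      adj≐ : ∀ u → adj G u ≐ adj ((G － v) △ star G v) u
      adj≐ u w with u ≟ v | w ≟ v
      ... | yes refl | yes refl rewrite irrefl G u = refl
      ... | yes refl | no  _    rewrite Bool.∧-zeroʳ (adj G u w) | Bool.∨-identityʳ (adj G u w) = refl
      ... | no  _    | yes refl rewrite Bool.∧-zeroʳ (adj G u w) = refl
      ... | no  _    | no  _    = sym (trans (Bool.xor-identityʳ _) (Bool.∧-identityʳ (adj G u w)))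

    -- Every row indexed by S is a multiple of one vector: of the row of v if v ∈ S (column v is then
    -- cut off), and of the unit vector at v otherwise.
    ρ-star-≤-1 : (S : VSet n) → ρ (star G v) S ≤ 1
    ρ-star-≤-1 S with S v in v∈S
    ... | true  = binRank-≤-length (adj H) C [ C ∩ adj G v ] λ i _ →
                    Span-cong (row≐ i) (Span-·-[] (i ≡ᵇ v) (C ∩ adj G v))
      where
      H = star G v
      C = V H ∖ S
      C-v : ∀ c → c ≡ᵇ v ≡ true → C c ≡ false
      C-v c c≡v rewrite ≡ᵇ⇒≡ c≡v | v∈S = Bool.∧-zeroʳ _
      entry : ∀ a b cc e f → (e ≡ true → cc ≡ false) → a ∧ (cc ∧ b) ≡ cc ∧ ((a ∧ b) ∨ (e ∧ f))
      entry a b false e     f _ = Bool.∧-zeroʳ a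
      entry a b true  true  f h = ⊥-elim (true≢false (h refl))
      entry a b true  false f _ = sym (Bool.∨-identityʳ (a ∧ b))
      row≐ : ∀ i → (i ≡ᵇ v) · (C ∩ adj G v) ≐ rows (adj H) C i
      row≐ i c = entry (i ≡ᵇ v) (adj G v c) (C c) (c ≡ᵇ v) (adj G i v) (C-v c)
    ... | false = binRank-≤-length (adj H) C [ C ∩ ⁅ v ⁆ ] λ i si →
                    Span-cong (row≐ i si) (Span-·-[] (adj G i v) (C ∩ ⁅ v ⁆))
      where
      H = star G v
      C = V H ∖ S
      i≢v : ∀ i → S i ≡ true → i ≡ᵇ v ≡ false
      i≢v i si with i ≟ v
      ... | yes refl = ⊥-elim (true≢false (trans (sym si) v∈S))
      ... | no  _    = refl
      entry : ∀ f cc e → f ∧ (cc ∧ e) ≡ cc ∧ (e ∧ f)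
      entry f false e = Bool.∧-zeroʳ f
      entry f true  e = Bool.∧-comm f e
      row≐ : ∀ i → S i ≡ true → adj G i v · (C ∩ ⁅ v ⁆) ≐ rows (adj H) C i
      row≐ i si c rewrite i≢v i si = entry (adj G i v) (C c) (c ≡ᵇ v)

open BinaryRank
open import Data.Bool using (true; false; _∧_)
open import Data.Fin using (Fin)
open import Data.Integer using (+_)
import Data.Integer as ℤ
import Data.Integer.Properties as ℤ
open import Data.List using (map)
open import Data.Nat using (ℕ; _^_)
import Data.Nat as ℕ
open import Data.Nat.ListAction using (sum)
open import Data.Nat.Properties using (m^n≢0)
import Data.Nat.Properties as ℕ
open import Data.Nat.Tactic.RingSolver using (solve-∀)
open import Data.Product using (_×_; _,_)
open import Data.Rational using (_≤_; _+_; _-_; -_; _/_; 1ℚ; toℚᵘ)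
import Data.Rational.Properties as ℚ
open import Data.Rational.Solver using (module +-*-Solver)
open import Data.Rational.Unnormalised using (mkℚᵘ; *≤*; *≡*) renaming (_/_ to _/ᵘ_; _≃_ to _≃ᵘ_)
import Data.Rational.Unnormalised.Properties as ℚᵘ
open import Relation.Binary.PropositionalEquality using (_≡_; refl; sym; trans; cong; cong₂; subst₂; module ≡-Reasoning)

private
  toℚᵘ-/ : ∀ a p .{{_ : ℕ.NonZero p}} → toℚᵘ (+ a / p) ≃ᵘ (+ a /ᵘ p)
  toℚᵘ-/ a (ℕ.suc p) = ℚ.toℚᵘ-fromℚᵘ (mkℚᵘ (+ a) p)

/-≤-/ : ∀ a b p q .{{_ : ℕ.NonZero p}} .{{_ : ℕ.NonZero q}} → a ℕ.* q ℕ.≤ b ℕ.* p → + a / p ≤ + b / q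
/-≤-/ a b p@(ℕ.suc _) q@(ℕ.suc _) aq≤bp = ℚ.toℚᵘ-cancel-≤
  (ℚᵘ.≤-respˡ-≃ (ℚᵘ.≃-sym (toℚᵘ-/ a p)) (ℚᵘ.≤-respʳ-≃ (ℚᵘ.≃-sym (toℚᵘ-/ b q))
    (*≤* (subst₂ ℤ._≤_ (ℤ.pos-* a q) (ℤ.pos-* b p) (ℤ.+≤+ aq≤bp)))))

/-≡-/ : ∀ a b p q .{{_ : ℕ.NonZero p}} .{{_ : ℕ.NonZero q}} → a ℕ.* q ≡ b ℕ.* p → + a / p ≡ + b / q
/-≡-/ a b p q aq≡bp =
  ℚ.≤-antisym (/-≤-/ a b p q (ℕ.≤-reflexive aq≡bp)) (/-≤-/ b a q p (ℕ.≤-reflexive (sym aq≡bp)))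

/-distribʳ-+ : ∀ a b p .{{_ : ℕ.NonZero p}} → + (a ℕ.+ b) / p ≡ + a / p + + b / p
/-distribʳ-+ a b p@(ℕ.suc _) = ℚ.toℚᵘ-injective (ℚᵘ.≃-trans (toℚᵘ-/ (a ℕ.+ b) p) (ℚᵘ.≃-trans (*≡* cross)
  (ℚᵘ.≃-sym (ℚᵘ.≃-trans (ℚ.toℚᵘ-homo-+ (+ a / p) (+ b / p)) (ℚᵘ.+-cong (toℚᵘ-/ a p) (toℚᵘ-/ b p))))))
  where
  open ≡-Reasoning
  distrib : ∀ a b p → (a ℕ.+ b) ℕ.* (p ℕ.* p) ≡ (a ℕ.* p ℕ.+ b ℕ.* p) ℕ.* p
  distrib = solve-∀
  cross : + (a ℕ.+ b) ℤ.* + (p ℕ.* p) ≡ (+ a ℤ.* + p ℤ.+ + b ℤ.* + p) ℤ.* + p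
  cross = begin
    + (a ℕ.+ b) ℤ.* + (p ℕ.* p)            ≡⟨ sym (ℤ.pos-* (a ℕ.+ b) (p ℕ.* p)) ⟩
    + ((a ℕ.+ b) ℕ.* (p ℕ.* p))            ≡⟨ cong +_ (distrib a b p) ⟩
    + ((a ℕ.* p ℕ.+ b ℕ.* p) ℕ.* p)        ≡⟨ ℤ.pos-* (a ℕ.* p ℕ.+ b ℕ.* p) p ⟩
    + (a ℕ.* p ℕ.+ b ℕ.* p) ℤ.* + p        ≡⟨ cong (ℤ._* + p) (trans (ℤ.pos-+ (a ℕ.* p) (b ℕ.* p))
                                                                   (cong₂ ℤ._+_ (ℤ.pos-* a p) (ℤ.pos-* b p))) ⟩
    (+ a ℤ.* + p ℤ.+ + b ℤ.* + p) ℤ.* + p  ∎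

x≤y+z∧z+w≤1⇒x-1+w≤y : ∀ {x y z w} → x ≤ y + z → z + w ≤ 1ℚ → (x - 1ℚ) + w ≤ y
x≤y+z∧z+w≤1⇒x-1+w≤y {x} {y} {z} {w} x≤y+z z+w≤1 = begin
  (x - 1ℚ) + w        ≤⟨ ℚ.+-monoˡ-≤ w (ℚ.+-monoˡ-≤ (- 1ℚ) x≤y+z) ⟩
  ((y + z) - 1ℚ) + w  ≡⟨ rearrange y z w ⟩
  y + ((z + w) - 1ℚ)  ≤⟨ ℚ.+-monoʳ-≤ y (ℚ.+-monoˡ-≤ (- 1ℚ) z+w≤1) ⟩
  y + (1ℚ - 1ℚ)       ≡⟨ trans (cong (λ q → y + q) (ℚ.+-inverseʳ 1ℚ)) (ℚ.+-identityʳ y) ⟩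
  y                   ∎
  where
  open ℚ.≤-Reasoning
  open +-*-Solver using (solve; _:+_; :-_; _:=_; con)
  rearrange : ∀ y z w → ((y + z) - 1ℚ) + w ≡ y + ((z + w) - 1ℚ)
  rearrange = solve 3 (λ y z w → ((y :+ z) :+ (:- con 1ℚ)) :+ w := y :+ ((z :+ w) :+ (:- con 1ℚ))) refl

𝔼ρ-cong : ∀ {n} {G G′ : Graph n} → G ≈ G′ → 𝔼ρ G ≡ 𝔼ρ G′
𝔼ρ-cong {G = G} {G′} G≈G′@(V≐ , _) =
  /-≡-/ (sumSubsets (V G) (ρ G)) (sumSubsets (V G′) (ρ G′)) (2 ^ ∣V∣ G) (2 ^ ∣V∣ G′)
        {{m^n≢0 2 (∣V∣ G)}} {{m^n≢0 2 (∣V∣ G′)}}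
        (cong₂ ℕ._*_ sums≡ (cong (2 ^_) (sym (card-cong V≐))))
  where
  sums≡ : sumSubsets (V G) (ρ G) ≡ sumSubsets (V G′) (ρ G′)
  sums≡ = trans (cong (λ Ss → sum (map (ρ G) Ss)) (subsetsOf-cong V≐))
                (sumSubsets-cong (V G′) λ S → ρ-cong {G = G} {G′} {S} G≈G′ λ _ → refl)

𝔼ρ-average : ∀ {n} (H : Graph n) (X : VSet n) → V H ⊆ X →
             𝔼ρ H ≡ (+ sumSubsets X (λ S → ρ H (S ∩ V H)) / 2 ^ card X) {{m^n≢0 2 (card X)}}
𝔼ρ-average H X V⊆X =
  /-≡-/ (sumSubsets (V H) (ρ H)) (sumSubsets X (λ S → ρ H (S ∩ V H))) (2 ^ ∣V∣ H) (2 ^ card X)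
        {{m^n≢0 2 (∣V∣ H)}} {{m^n≢0 2 (card X)}} (begin
    sumSubsets (V H) (ρ H) ℕ.* 2 ^ card X
      ≡⟨ ℕ.*-comm _ (2 ^ card X) ⟩
    2 ^ card X ℕ.* sumSubsets (V H) (ρ H)
      ≡⟨ sym (sumSubsets-∩ (V H) X V⊆X (ρ H) (ρ-cong {G = H} {H} ((λ _ → refl) , λ _ _ → refl))) ⟩
    2 ^ ∣V∣ H ℕ.* sumSubsets X (λ S → ρ H (S ∩ V H))
      ≡⟨ ℕ.*-comm (2 ^ ∣V∣ H) _ ⟩
    sumSubsets X (λ S → ρ H (S ∩ V H)) ℕ.* 2 ^ ∣V∣ H
      ∎)
  where open ≡-Reasoning

module _ {n : ℕ} (G₁ G₂ : Graph n) where

  private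
    X = V (G₁ △ G₂)
    P = 2 ^ card X
    instance
      P≢0 : ℕ.NonZero P
      P≢0 = m^n≢0 2 (card X)
    A : Graph n → ℕ
    A H = sumSubsets X (λ S → ρ H (S ∩ V H))

    𝔼ρ-parts : + (A G₁ ℕ.+ A G₂) / P ≡ 𝔼ρ G₁ + 𝔼ρ G₂
    𝔼ρ-parts = trans (/-distribʳ-+ (A G₁) (A G₂) P)
                     (sym (cong₂ _+_ (𝔼ρ-average G₁ X λ u → ∨-introˡ (V G₂ u))
                                     (𝔼ρ-average G₂ X λ u → ∨-introʳ (V G₁ u))))

    sum-parts : sumSubsets X (λ S → ρ G₁ (S ∩ V G₁) ℕ.+ ρ G₂ (S ∩ V G₂)) ≡ A G₁ ℕ.+ A G₂
    sum-parts = sumSubsets-+ X (λ S → ρ G₁ (S ∩ V G₁)) (λ S → ρ G₂ (S ∩ V G₂))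

  𝔼ρ-△-≤ : 𝔼ρ (G₁ △ G₂) ≤ 𝔼ρ G₁ + 𝔼ρ G₂
  𝔼ρ-△-≤ = begin
    𝔼ρ (G₁ △ G₂)           ≤⟨ /-≤-/ (sumSubsets X (ρ (G₁ △ G₂))) (A G₁ ℕ.+ A G₂) P P (ℕ.*-monoˡ-≤ P sums≤) ⟩
    + (A G₁ ℕ.+ A G₂) / P  ≡⟨ 𝔼ρ-parts ⟩
    𝔼ρ G₁ + 𝔼ρ G₂          ∎
    where
    open ℚ.≤-Reasoning
    sums≤ : sumSubsets X (ρ (G₁ △ G₂)) ℕ.≤ A G₁ ℕ.+ A G₂
    sums≤ = ℕ.≤-trans (sumSubsets-mono X (ρ-△-≤ G₁ G₂)) (ℕ.≤-reflexive sum-parts)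

  𝔼ρ-△-disjoint : V G₁ ∩ V G₂ ≐ ∅ → 𝔼ρ (G₁ △ G₂) ≡ 𝔼ρ G₁ + 𝔼ρ G₂
  𝔼ρ-△-disjoint disjoint =
    trans (/-≡-/ (sumSubsets X (ρ (G₁ △ G₂))) (A G₁ ℕ.+ A G₂) P P (cong (ℕ._* P) sums≡)) 𝔼ρ-parts
    where
    sums≡ : sumSubsets X (ρ (G₁ △ G₂)) ≡ A G₁ ℕ.+ A G₂
    sums≡ = trans (sumSubsets-cong X λ S → ℕ.≤-antisym (ρ-△-≤ G₁ G₂ S) (ρ-△-≥ G₁ G₂ disjoint S)) sum-parts

module _ {n : ℕ} (G : Graph n) (v : Fin n) where

  private
    H = star G v
    d = deg G v
    instance
      2^d≢0 : ℕ.NonZero (2 ^ d)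
      2^d≢0 = m^n≢0 2 d
      2^∣V∣≢0 : ℕ.NonZero (2 ^ ∣V∣ G)
      2^∣V∣≢0 = m^n≢0 2 (∣V∣ G)
      2^∣V∣H≢0 : ℕ.NonZero (2 ^ ∣V∣ H)
      2^∣V∣H≢0 = m^n≢0 2 (∣V∣ H)

  𝔼ρ-star-+-≤-1 : 𝔼ρ H + + 1 / 2 ^ d ≤ 1ℚ
  𝔼ρ-star-+-≤-1 = begin
    + s / 2 ^ ∣V∣ H + + 1 / 2 ^ d      ≡⟨ cong (λ q → + s / 2 ^ ∣V∣ H + q) (/-≡-/ 1 2 (2 ^ d) (2 ^ ∣V∣ H) halve) ⟩
    + s / 2 ^ ∣V∣ H + + 2 / 2 ^ ∣V∣ H  ≡⟨ sym (/-distribʳ-+ s 2 (2 ^ ∣V∣ H)) ⟩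
    + (s ℕ.+ 2) / 2 ^ ∣V∣ H            ≤⟨ /-≤-/ (s ℕ.+ 2) 1 (2 ^ ∣V∣ H) 1 bound ⟩
    1ℚ                                 ∎
    where
    open ℚ.≤-Reasoning
    s = sumSubsets (V H) (ρ H)
    halve : 1 ℕ.* 2 ^ ∣V∣ H ≡ 2 ℕ.* 2 ^ d
    halve = trans (ℕ.*-identityˡ _) (cong (2 ^_) (card-star G v))
    bound : (s ℕ.+ 2) ℕ.* 1 ℕ.≤ 1 ℕ.* 2 ^ ∣V∣ H
    bound = subst₂ ℕ._≤_ (trans (ℕ.+-comm 2 s) (sym (ℕ.*-identityʳ _))) (sym (ℕ.*-identityˡ _))
      (sumSubsets-+2-≤ (V H) (ρ H) (ρ-star-≤-1 G v) (star-nonempty G v) (λ _ → ρ-empty H) (λ _ → ρ-full H))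

  module _ (v∈G : V G v ≡ true) where

    𝔼ρ-－-≥ : (𝔼ρ G - 1ℚ) + + 1 / 2 ^ d ≤ 𝔼ρ (G － v)
    𝔼ρ-－-≥ = x≤y+z∧z+w≤1⇒x-1+w≤y
      (ℚ.≤-trans (ℚ.≤-reflexive (𝔼ρ-cong {G = G} {(G － v) △ H} (－-△-star G v v∈G))) (𝔼ρ-△-≤ (G － v) H))
      𝔼ρ-star-+-≤-1

    2/2^∣V∣≤1/2^deg : + 2 / 2 ^ ∣V∣ G ≤ + 1 / 2 ^ d
    2/2^∣V∣≤1/2^deg = /-≤-/ 2 1 (2 ^ ∣V∣ G) (2 ^ d) (begin
      2 ℕ.* 2 ^ d      ≡⟨ cong (2 ^_) (sym (card-star G v)) ⟩
      2 ^ ∣V∣ H        ≤⟨ ℕ.^-monoʳ-≤ 2 (card-mono (V H) (V G) (star-⊆ G v v∈G)) ⟩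
      2 ^ ∣V∣ G        ≡⟨ sym (ℕ.*-identityˡ _) ⟩
      1 ℕ.* 2 ^ ∣V∣ G  ∎)
      where open ℕ.≤-Reasoning

proposition4p4 :
  (∀ (n : ℕ) (G₁ G₂ : Graph n) →
    (𝔼ρ (G₁ △ G₂) ≤ 𝔼ρ G₁ + 𝔼ρ G₂)
    × ((∀ u → (V G₁ u ∧ V G₂ u) ≡ false) → 𝔼ρ (G₁ △ G₂) ≡ 𝔼ρ G₁ + 𝔼ρ G₂))
  × (∀ (n : ℕ) (G : Graph n) (v : Fin n) → V G v ≡ true →
    ((𝔼ρ G - 1ℚ) + _/_ (+ 1) (2 ^ deg G v) {{m^n≢0 2 (deg G v)}} ≤ 𝔼ρ (G － v))
    × ((𝔼ρ G - 1ℚ) + _/_ (+ 2) (2 ^ ∣V∣ G) {{m^n≢0 2 (∣V∣ G)}}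
        ≤ (𝔼ρ G - 1ℚ) + _/_ (+ 1) (2 ^ deg G v) {{m^n≢0 2 (deg G v)}}))
proposition4p4 =
    (λ _ G₁ G₂ → 𝔼ρ-△-≤ G₁ G₂ , 𝔼ρ-△-disjoint G₁ G₂)
  , (λ _ G v v∈G → 𝔼ρ-－-≥ G v v∈G , ℚ.+-monoʳ-≤ (𝔼ρ G - 1ℚ) (2/2^∣V∣≤1/2^deg G v v∈G))
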